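{- Let $q\geqslant2$ be an even integer and $n\geqslant2$ an even integer. Let $S=\mathrm{SB}^{+}_{\mathcal{GM}^q}(n)\cup\mathrm{SB}^{ - }_{\mathcal{GM}^q}(n)$ and let $\mathrm{Sp}_H(S)=\{\mathrm{dist}_H(f_1,f_2): f_1,f_2\in S\}$. Then $$\mathrm{Sp}_H(S)=\{2^{n-1}\}\cup\bigcup_{r=0}^{n/2-1}\left\{2^{n-1}\left(1\pm\frac{1}{2^r}\right)\right\}.$$
   Context: $\mathrm{dist}_H(f,g)=|\{x: f(x)\neq g(x)\}|$. $\mathrm{SB}^{+}_{\mathcal{GM}^q}(n)$ (resp. $\mathrm{SB}^{ - }_{\mathcal{GM}^q}(n)$) is the set of self-dual (resp. anti-self-dual) functions $f:\mathbb{F}_2^{n/2}\times\mathbb{F}_2^{n/2}\to\mathbb{Z}_q$ of the form $f(x,y)=\frac q2\langle x,\pi(y)\rangle+g(y)$, $\pi$ a permutation of $\mathbb{F}_2^{n/2}$, $g:\mathbb{F}_2^{n/2}\to\mathbb{Z}_q$. With $\omega=e^{2\pi i/q}$, $H_f(u)=\sum_x\omega^{f(x)}(-1)^{\langle x,u\rangle}$; $f$ is self-dual if $H_f(u)=2^{n/2}\omega^{f(u)}$ for all $u$, anti-self-dual if $H_f(u)=2^{n/2}\omega^{f(u)+q/2}$ for all $u$. -}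

module Defs where

open import Level using (Level)
open import Data.Bool using (Bool; true; false; _xor_; _∧_; if_then_else_)
open import Data.Nat using (ℕ; zero; suc; _∸_; _^_; _<_; NonZero)
import Data.Nat as ℕ
open import Data.Nat.DivMod using (_/_; _mod_)
open import Data.Fin using (Fin; toℕ)
import Data.Fin as Fin
open import Data.Vec using (Vec; []; _∷_)
open import Data.List using (List; []; _∷_; map; length; filter; _++_; foldr; cartesianProductWith)
open import Data.Product using (Σ; _×_; _,_; ∃; ∃-syntax)
open import Data.Sum using (_⊎_)
open import Relation.Nullary using (¬_)
open import Relation.Nullary.Decidable using (¬?)
open import Relation.Binary.PropositionalEquality using (_≡_)
open import Algebra.Bundles using (CommutativeRing)
open import Function.Bundles using (_↔_; Inverse)

Bits : ℕ → Set
Bits m = Vec Bool m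

allBits : (m : ℕ) → List (Bits m)
allBits zero = [] ∷ []
allBits (suc m) = map (false ∷_) (allBits m) ++ map (true ∷_) (allBits m)

-- F₂^m × F₂^m  (= F₂^n with n = 2m)
allPairs : (m : ℕ) → List (Bits m × Bits m)
allPairs m = cartesianProductWith _,_ (allBits m) (allBits m)

dot : ∀ {m} → Bits m → Bits m → Bool
dot [] [] = false
dot (a ∷ x) (b ∷ y) = (a ∧ b) xor dot x y

-- functions F₂^{n/2} × F₂^{n/2} → ℤ_q  (ℤ_q represented by Fin q)
Fn : ℕ → ℕ → Set
Fn m q = Bits m → Bits m → Fin q

distH : ∀ {m q} → Fn m q → Fn m q → ℕ
distH {m} f g = length (filter (λ p → ¬? (f (Data.Product.proj₁ p) (Data.Product.proj₂ p)
                                          Fin.≟ g (Data.Product.proj₁ p) (Data.Product.proj₂ p)))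
                               (allPairs m))

IsGM : ∀ {m} (q : ℕ) .{{_ : NonZero q}} → Fn m q → Set
IsGM {m} q f =
  Σ (Bits m ↔ Bits m) λ π → Σ (Bits m → Fin q) λ g →
    ∀ x y → f x y ≡ ((if dot x (Inverse.to π y) then q / 2 else 0) ℕ.+ toℕ (g y)) mod q

-- A commutative ring R with an element ω that behaves like e^{2πi/q} in ℂ:
-- R is a nontrivial integral domain of characteristic 0 and ω is a root of
-- unity of exact order q.  (Then ℤ[ω] ⊆ R is isomorphic to ℤ[e^{2πi/q}] ⊆ ℂ.)
module Walsh {c ℓ} (R : CommutativeRing c ℓ) where
  open CommutativeRing R

  pow : Carrier → ℕ → Carrier
  pow a zero = 1#
  pow a (suc k) = a * pow a k

  fromℕ : ℕ → Carrier
  fromℕ zero = 0#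
  fromℕ (suc k) = 1# + fromℕ k

  record CyclotomicSetting (q : ℕ) (ω : Carrier) : Set (c Level.⊔ ℓ) where
    field
      nontrivial    : ¬ (1# ≈ 0#)
      noZeroDivisor : ∀ a b → a * b ≈ 0# → (a ≈ 0#) ⊎ (b ≈ 0#)
      charZero      : ∀ k → fromℕ k ≈ 0# → k ≡ 0
      ω^q≈1         : pow ω q ≈ 1#
      exactOrder    : ∀ k → 0 < k → k < q → ¬ (pow ω k ≈ 1#)

  sign : Bool → Carrier
  sign false = 1#
  sign true = - 1#

  sumR : List Carrier → Carrier
  sumR = foldr _+_ 0#

  H : ∀ {m q} → Carrier → Fn m q → Bits m → Bits m → Carrier
  H {m} ω f u v = sumR (map (λ p → pow ω (toℕ (f (Data.Product.proj₁ p) (Data.Product.proj₂ p)))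
                                   * sign (dot (Data.Product.proj₁ p) u xor dot (Data.Product.proj₂ p) v))
                            (allPairs m))

  -- self-dual: H_f(u) = 2^{n/2} ω^{f(u)}   (n = 2m, so 2^{n/2} = 2^m)
  SelfDual : ∀ {m} (q : ℕ) → Carrier → Fn m q → Set ℓ
  SelfDual {m} q ω f = ∀ u v → H ω f u v ≈ fromℕ (2 ^ m) * pow ω (toℕ (f u v))

  AntiSelfDual : ∀ {m} (q : ℕ) → Carrier → Fn m q → Set ℓ
  AntiSelfDual {m} q ω f = ∀ u v → H ω f u v ≈ fromℕ (2 ^ m) * pow ω (toℕ (f u v) ℕ.+ q / 2)

  InS : ∀ {m} (q : ℕ) .{{_ : NonZero q}} → Carrier → Fn m q → Set ℓ
  InS q ω f = IsGM q f × (SelfDual q ω f ⊎ AntiSelfDual q ω f)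

  InSpectrum : (m q : ℕ) .{{_ : NonZero q}} → Carrier → ℕ → Set ℓ
  InSpectrum m q ω d = ∃[ f₁ ] ∃[ f₂ ] (InS {m} q ω f₁ × InS {m} q ω f₂ × distH f₁ f₂ ≡ d)

-- d ∈ {2^{n-1}} ∪ ⋃_{r=0}^{n/2-1} {2^{n-1}(1 ± 2^{-r})}, with n = 2m,
-- using 2^{n-1}(1 ± 2^{-r}) = 2^{n-1} ± 2^{n-1-r}
InTarget : (m d : ℕ) → Set
InTarget m d =
  d ≡ 2 ^ (2 ℕ.* m ∸ 1)
  ⊎ ∃[ r ] (r < m × (d ≡ 2 ^ (2 ℕ.* m ∸ 1) ℕ.+ 2 ^ (2 ℕ.* m ∸ 1 ∸ r)
                     ⊎ d ≡ 2 ^ (2 ℕ.* m ∸ 1) ∸ 2 ^ (2 ℕ.* m ∸ 1 ∸ r)))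

{-# OPTIONS --safe #-}
module Submission where

-- Comparing the Walsh transform of f(x,y) = (q/2)⟨x,π y⟩ + g(y) with its (anti-)self-dual value shows
-- that ω^g(y) = (-1)^⟨L y, p⟩ ω^g(0) where π y = L y ⊕ p and L is a linear isometry of F₂^m with L 𝟙 = 𝟙.
-- Hence for f₁, f₂ ∈ S either g₁(0) − g₂(0) ∉ {0, q/2} and the functions differ everywhere, or the
-- distance is the number of (x,y) with ⟨x, a y⟩ ⊕ k y (or its complement), where a is affine and k linear.
-- Summing over x leaves 2^(m-1) #{a y ≠ 0} + 2^m #{a y = 0, k y}. On the affine space {a = 0} the two
-- level sets of k are affine, invariant under translation by 𝟙, and translates of each other when both
-- are nonempty, so their sizes are equal, or one is 0 and the other 2^(i+1) with i < m; this yields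
-- exactly 2^(n-1) and 2^(n-1) ± 2^(n-1-r). Conversely, rotations of coordinates (self-dual, with 2^(m-t)
-- fixed points) and one translation (anti-self-dual) realise every value.

open import Defs
open import Level using (Level)
open import Algebra.Bundles using (CommutativeRing; CommutativeMonoid)
open import Data.Nat using (ℕ; NonZero; _≤_)
open import Data.Nat.Divisibility using (_∣_)
open import Function.Bundles using (_⇔_)

module BitVector where

  open import Data.Bool using (Bool; true; false; _xor_; _∧_; not)
  open import Data.Bool.Properties
    using (xor-comm; xor-same; xor-identityʳ; ∧-distribˡ-xor; xor-assoc; ∧-comm)
  import Data.Bool.Properties as Bool
  open import Data.Nat using (suc)
  open import Data.Vec using ([]; _∷_; replicate)
  open import Data.Vec.Properties using (≡-dec)
  open import Data.Bool.Solver using (module xor-∧-Solver)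
  open xor-∧-Solver using (solve; _:+_; _:=_)
  open import Relation.Nullary using (¬_)
  open import Relation.Binary.Definitions using (DecidableEquality)
  open import Relation.Binary.PropositionalEquality

  infixl 6 _⊕_
  _⊕_ : ∀ {m} → Bits m → Bits m → Bits m
  [] ⊕ [] = []
  (a ∷ x) ⊕ (b ∷ y) = (a xor b) ∷ (x ⊕ y)

  𝟘 𝟙 : ∀ m → Bits m
  𝟘 m = replicate m false
  𝟙 m = replicate m true

  infix 4 _≟_
  _≟_ : ∀ {m} → DecidableEquality (Bits m)
  _≟_ = ≡-dec Bool._≟_

  ⊕-assoc : ∀ {m} (x y z : Bits m) → x ⊕ y ⊕ z ≡ x ⊕ (y ⊕ z)
  ⊕-assoc [] [] [] = refl
  ⊕-assoc (a ∷ x) (b ∷ y) (c ∷ z) = cong₂ _∷_ (xor-assoc a b c) (⊕-assoc x y z)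

  ⊕-comm : ∀ {m} (x y : Bits m) → x ⊕ y ≡ y ⊕ x
  ⊕-comm [] [] = refl
  ⊕-comm (a ∷ x) (b ∷ y) = cong₂ _∷_ (xor-comm a b) (⊕-comm x y)

  ⊕-identityʳ : ∀ {m} (x : Bits m) → x ⊕ 𝟘 m ≡ x
  ⊕-identityʳ [] = refl
  ⊕-identityʳ (a ∷ x) = cong₂ _∷_ (xor-identityʳ a) (⊕-identityʳ x)

  ⊕-identityˡ : ∀ {m} (x : Bits m) → 𝟘 m ⊕ x ≡ x
  ⊕-identityˡ x = trans (⊕-comm _ x) (⊕-identityʳ x)

  ⊕-self : ∀ {m} (x : Bits m) → x ⊕ x ≡ 𝟘 m
  ⊕-self [] = refl
  ⊕-self (a ∷ x) = cong₂ _∷_ (xor-same a) (⊕-self x)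

  ⊕-cancelʳ : ∀ {m} (x t : Bits m) → x ⊕ t ⊕ t ≡ x
  ⊕-cancelʳ x t = trans (⊕-assoc x t t) (trans (cong (x ⊕_) (⊕-self t)) (⊕-identityʳ x))

  ⊕-interchange : ∀ {m} (a b c d : Bits m) → (a ⊕ b) ⊕ (c ⊕ d) ≡ (a ⊕ c) ⊕ (b ⊕ d)
  ⊕-interchange a b c d = begin
    (a ⊕ b) ⊕ (c ⊕ d) ≡⟨ ⊕-assoc a b (c ⊕ d) ⟩
    a ⊕ (b ⊕ (c ⊕ d)) ≡⟨ cong (a ⊕_) (trans (sym (⊕-assoc b c d)) (cong (_⊕ d) (⊕-comm b c))) ⟩
    a ⊕ (c ⊕ b ⊕ d)   ≡⟨ cong (a ⊕_) (⊕-assoc c b d) ⟩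
    a ⊕ (c ⊕ (b ⊕ d)) ≡⟨ sym (⊕-assoc a c (b ⊕ d)) ⟩
    (a ⊕ c) ⊕ (b ⊕ d) ∎
    where open ≡-Reasoning

  x⊕y≡𝟘⇒x≡y : ∀ {m} (x y : Bits m) → x ⊕ y ≡ 𝟘 m → x ≡ y
  x⊕y≡𝟘⇒x≡y x y e = trans (sym (⊕-cancelʳ x y)) (trans (cong (_⊕ y) e) (⊕-identityˡ y))

  x⊕𝟙≢x : ∀ {m} (x : Bits (suc m)) → ¬ (x ⊕ 𝟙 (suc m) ≡ x)
  x⊕𝟙≢x (false ∷ _) ()
  x⊕𝟙≢x (true ∷ _) ()

  dot-comm : ∀ {m} (x y : Bits m) → dot x y ≡ dot y x
  dot-comm [] [] = refl
  dot-comm (a ∷ x) (b ∷ y) = cong₂ _xor_ (∧-comm a b) (dot-comm x y)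

  dot-zeroʳ : ∀ {m} (x : Bits m) → dot x (𝟘 m) ≡ false
  dot-zeroʳ [] = refl
  dot-zeroʳ (false ∷ x) = dot-zeroʳ x
  dot-zeroʳ (true ∷ x) = dot-zeroʳ x

  dot-zeroˡ : ∀ {m} (x : Bits m) → dot (𝟘 m) x ≡ false
  dot-zeroˡ x = trans (dot-comm _ x) (dot-zeroʳ x)

  xor-interchange : ∀ a b c d → (a xor b) xor (c xor d) ≡ (a xor c) xor (b xor d)
  xor-interchange = solve 4 (λ a b c d → (a :+ b) :+ (c :+ d) := (a :+ c) :+ (b :+ d)) refl

  dot-distribˡ-⊕ : ∀ {m} (x a b : Bits m) → dot x (a ⊕ b) ≡ dot x a xor dot x b
  dot-distribˡ-⊕ [] [] [] = refl
  dot-distribˡ-⊕ (c ∷ x) (a ∷ xa) (b ∷ xb) =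
    trans (cong₂ _xor_ (∧-distribˡ-xor c a b) (dot-distribˡ-⊕ x xa xb))
          (xor-interchange (c ∧ a) (c ∧ b) (dot x xa) (dot x xb))

  dot-distribʳ-⊕ : ∀ {m} (a b x : Bits m) → dot (a ⊕ b) x ≡ dot a x xor dot b x
  dot-distribʳ-⊕ a b x =
    trans (dot-comm (a ⊕ b) x) (trans (dot-distribˡ-⊕ x a b) (cong₂ _xor_ (dot-comm x a) (dot-comm x b)))

  dot-self : ∀ {m} (x : Bits m) → dot x x ≡ dot x (𝟙 m)
  dot-self [] = refl
  dot-self (false ∷ x) = dot-self x
  dot-self (true ∷ x) = cong not (dot-self x)

  dot-nondegenerate : ∀ {m} (y : Bits m) → (∀ x → dot x y ≡ false) → y ≡ 𝟘 m
  dot-nondegenerate [] _ = refl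
  dot-nondegenerate (a ∷ y) h = cong₂ _∷_ head≡false (dot-nondegenerate y (λ x → h (false ∷ x)))
    where
    head≡false : a ≡ false
    head≡false = trans (sym (trans (cong (a xor_) (dot-zeroˡ y)) (xor-identityʳ a))) (h (true ∷ 𝟘 _))

  module Isometry {m} (L L⁻¹ : Bits m → Bits m) (L∘L⁻¹ : ∀ z → L (L⁻¹ z) ≡ z)
                  (L-isometry : ∀ x y → dot (L x) (L y) ≡ dot x y) where

    ⊥-image⇒𝟘 : ∀ y → (∀ w → dot (L w) y ≡ false) → y ≡ 𝟘 m
    ⊥-image⇒𝟘 y h = dot-nondegenerate y (λ z → trans (cong (λ t → dot t y) (sym (L∘L⁻¹ z))) (h (L⁻¹ z)))

    L-⊕ : ∀ a b → L (a ⊕ b) ≡ L a ⊕ L b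
    L-⊕ a b = x⊕y≡𝟘⇒x≡y _ _ (⊥-image⇒𝟘 _ λ w → begin
      dot (L w) (L (a ⊕ b) ⊕ (L a ⊕ L b))
        ≡⟨ trans (dot-distribˡ-⊕ (L w) _ _) (cong (dot (L w) (L (a ⊕ b)) xor_) (dot-distribˡ-⊕ (L w) _ _)) ⟩
      dot (L w) (L (a ⊕ b)) xor (dot (L w) (L a) xor dot (L w) (L b))
        ≡⟨ cong₂ _xor_ (L-isometry w (a ⊕ b)) (cong₂ _xor_ (L-isometry w a) (L-isometry w b)) ⟩
      dot w (a ⊕ b) xor (dot w a xor dot w b)
        ≡⟨ cong (_xor (dot w a xor dot w b)) (dot-distribˡ-⊕ w a b) ⟩
      (dot w a xor dot w b) xor (dot w a xor dot w b)
        ≡⟨ xor-same (dot w a xor dot w b) ⟩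
      false ∎)
      where open ≡-Reasoning

    L-𝟙 : L (𝟙 m) ≡ 𝟙 m
    L-𝟙 = x⊕y≡𝟘⇒x≡y _ _ (⊥-image⇒𝟘 _ λ w → begin
      dot (L w) (L (𝟙 m) ⊕ 𝟙 m)               ≡⟨ dot-distribˡ-⊕ (L w) _ _ ⟩
      dot (L w) (L (𝟙 m)) xor dot (L w) (𝟙 m) ≡⟨ cong₂ _xor_ (L-isometry w (𝟙 m)) (sym (dot-self (L w))) ⟩
      dot w (𝟙 m) xor dot (L w) (L w)         ≡⟨ cong (dot w (𝟙 m) xor_) (trans (L-isometry w w) (dot-self w)) ⟩
      dot w (𝟙 m) xor dot w (𝟙 m)             ≡⟨ xor-same (dot w (𝟙 m)) ⟩
      false                                   ∎)
      where open ≡-Reasoning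

  -- In the application h w is the sign of ω^g(w) relative to ω^g(0), and the hypothesis below is
  -- what (anti-)self-duality of the Maiorana–McFarland function says about these signs.
  module IsometryFromDuality {m} (π : Bits m → Bits m) (ε : Bool) where

    p : Bits m
    p = π (𝟘 m)

    L : Bits m → Bits m
    L w = π w ⊕ p

    h : Bits m → Bool
    h w = ε xor dot (π w) p

    module _ (duality : ∀ w v → h w xor dot w v ≡ (ε xor dot (π w) (π v)) xor h v) where

      ε≡dot-p-p : ε ≡ dot p p
      ε≡dot-p-p = trans (cancelʳ ε (dot p p)) (cong (_xor dot p p) h𝟘≡false)
        where
        h𝟘≡false : h (𝟘 m) ≡ false
        h𝟘≡false = begin
          h (𝟘 m)                          ≡⟨ xor-identityʳ _ ⟨
          h (𝟘 m) xor false                ≡⟨ cong (h (𝟘 m) xor_) (dot-zeroʳ (𝟘 m)) ⟨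
          h (𝟘 m) xor dot (𝟘 m) (𝟘 m)      ≡⟨ duality (𝟘 m) (𝟘 m) ⟩
          h (𝟘 m) xor h (𝟘 m)              ≡⟨ xor-same (h (𝟘 m)) ⟩
          false                            ∎
          where open ≡-Reasoning
        cancelʳ : ∀ a b → a ≡ (a xor b) xor b
        cancelʳ = solve 2 (λ a b → a := (a :+ b) :+ b) refl

      h≡dot-L-p : ∀ w → h w ≡ dot (L w) p
      h≡dot-L-p w = trans (cong (_xor dot (π w) p) ε≡dot-p-p)
        (trans (xor-comm (dot p p) _) (sym (dot-distribʳ-⊕ (π w) p p)))

      L-isometry : ∀ w v → dot (L w) (L v) ≡ dot w v
      L-isometry w v = begin
        dot (L w) (L v)                   ≡⟨ dot-distribˡ-⊕ (L w) (π v) p ⟩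
        dot (L w) (π v) xor dot (L w) p   ≡⟨ cong₂ _xor_ (dot-distribʳ-⊕ (π w) p (π v)) (sym (h≡dot-L-p w)) ⟩
        (a xor dot p (π v)) xor h w       ≡⟨ cong (λ t → (a xor t) xor h w) (trans (dot-comm p (π v)) (unfold-h ε (dot (π v) p))) ⟩
        (a xor (ε xor h v)) xor h w       ≡⟨ rearrange a (h v) ε (h w) ⟩
        h w xor ((ε xor a) xor h v)       ≡⟨ cong (h w xor_) (duality w v) ⟨
        h w xor (h w xor dot w v)         ≡⟨ cancelˡ (h w) (dot w v) ⟩
        dot w v                           ∎
        where
        open ≡-Reasoning
        a = dot (π w) (π v)
        unfold-h : ∀ e x → x ≡ e xor (e xor x)
        unfold-h = solve 2 (λ e x → x := e :+ (e :+ x)) refl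
        rearrange : ∀ a b e d → (a xor (e xor b)) xor d ≡ d xor ((e xor a) xor b)
        rearrange = solve 4 (λ a b e d → (a :+ (e :+ b)) :+ d := d :+ ((e :+ a) :+ b)) refl
        cancelˡ : ∀ d t → d xor (d xor t) ≡ t
        cancelˡ = solve 2 (λ d t → d :+ (d :+ t) := t) refl

module Summation {c ℓ} (M : CommutativeMonoid c ℓ) where

  open CommutativeMonoid M renaming (Carrier to A)
  open import Data.Bool using (false; true; if_then_else_)
  open import Data.Nat using (zero; suc)
  open import Data.Vec using ([]; _∷_)
  open import Data.List using (List; []; _∷_; map; _++_; foldr; cartesianProductWith)
  open import Data.List.Properties using (map-∘)
  open import Data.Product using (_×_; _,_)
  open import Function using (_∘_)
  open import Relation.Nullary using (does)
  open import Algebra.Properties.CommutativeSemigroup commutativeSemigroup using (interchange)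
  import Relation.Binary.PropositionalEquality as ≡
  open import Relation.Binary.Reasoning.Setoid setoid
  open BitVector using (_⊕_; _≟_)

  sumMap : {B : Set} → (B → A) → List B → A
  sumMap F xs = foldr _∙_ ε (map F xs)

  sumBits : ∀ m → (Bits m → A) → A
  sumBits m F = sumMap F (allBits m)

  module _ {B : Set} where

    sumMap-cong : ∀ {F G : B → A} → (∀ x → F x ≈ G x) → ∀ xs → sumMap F xs ≈ sumMap G xs
    sumMap-cong h [] = refl
    sumMap-cong h (x ∷ xs) = ∙-cong (h x) (sumMap-cong h xs)

    sumMap-ε : ∀ xs → sumMap {B} (λ _ → ε) xs ≈ ε
    sumMap-ε [] = refl
    sumMap-ε (x ∷ xs) = trans (identityˡ _) (sumMap-ε xs)

    sumMap-∙ : ∀ (F G : B → A) xs → sumMap (λ x → F x ∙ G x) xs ≈ sumMap F xs ∙ sumMap G xs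
    sumMap-∙ F G [] = sym (identityˡ _)
    sumMap-∙ F G (x ∷ xs) = trans (∙-congˡ (sumMap-∙ F G xs)) (interchange _ _ _ _)

    sumMap-++ : ∀ (F : B → A) xs ys → sumMap F (xs ++ ys) ≈ sumMap F xs ∙ sumMap F ys
    sumMap-++ F [] ys = sym (identityˡ _)
    sumMap-++ F (x ∷ xs) ys = trans (∙-congˡ (sumMap-++ F xs ys)) (sym (assoc _ _ _))

    sumMap-map : ∀ {C : Set} (F : B → A) (g : C → B) xs → sumMap F (map g xs) ≈ sumMap (F ∘ g) xs
    sumMap-map F g xs = reflexive (≡.cong (foldr _∙_ ε) (≡.sym (map-∘ xs)))

  sumMap-swap : ∀ {B C : Set} (F : B → C → A) xs ys →
                sumMap (λ x → sumMap (F x) ys) xs ≈ sumMap (λ y → sumMap (λ x → F x y) xs) ys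
  sumMap-swap F [] ys = sym (sumMap-ε ys)
  sumMap-swap F (x ∷ xs) ys =
    trans (∙-congˡ (sumMap-swap F xs ys)) (sym (sumMap-∙ (F x) (λ y → sumMap (λ x → F x y) xs) ys))

  sumMap-cartesianProduct : ∀ {B C : Set} (F : B × C → A) xs ys →
    sumMap F (cartesianProductWith _,_ xs ys) ≈ sumMap (λ x → sumMap (λ y → F (x , y)) ys) xs
  sumMap-cartesianProduct F [] ys = refl
  sumMap-cartesianProduct F (x ∷ xs) ys = trans (sumMap-++ F (map (x ,_) ys) _)
    (∙-cong (sumMap-map F (x ,_) ys) (sumMap-cartesianProduct F xs ys))

  sumBits-suc : ∀ m (F : Bits (suc m) → A) →
                sumBits (suc m) F ≈ sumBits m (F ∘ (false ∷_)) ∙ sumBits m (F ∘ (true ∷_))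
  sumBits-suc m F = trans (sumMap-++ F (map (false ∷_) (allBits m)) _)
    (∙-cong (sumMap-map F _ (allBits m)) (sumMap-map F _ (allBits m)))

  sumBits-cong : ∀ m {F G : Bits m → A} → (∀ x → F x ≈ G x) → sumBits m F ≈ sumBits m G
  sumBits-cong m h = sumMap-cong h (allBits m)

  sumBits-∙ : ∀ m (F G : Bits m → A) → sumBits m (λ x → F x ∙ G x) ≈ sumBits m F ∙ sumBits m G
  sumBits-∙ m F G = sumMap-∙ F G (allBits m)

  sumBits-ε : ∀ m → sumBits m (λ _ → ε) ≈ ε
  sumBits-ε m = sumMap-ε (allBits m)

  sumBits-swap : ∀ m k (F : Bits m → Bits k → A) →
    sumBits m (λ x → sumBits k (F x)) ≈ sumBits k (λ y → sumBits m (λ x → F x y))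
  sumBits-swap m k F = sumMap-swap F (allBits m) (allBits k)

  sumPairs : ∀ m (F : Bits m × Bits m → A) →
    sumMap F (allPairs m) ≈ sumBits m (λ x → sumBits m (λ y → F (x , y)))
  sumPairs m F = sumMap-cartesianProduct F (allBits m) (allBits m)

  sumBits-translate : ∀ m (F : Bits m → A) t → sumBits m (λ y → F (y ⊕ t)) ≈ sumBits m F
  sumBits-translate zero F [] = refl
  sumBits-translate (suc m) F (false ∷ t) = begin
    sumBits (suc m) (λ y → F (y ⊕ (false ∷ t)))
      ≈⟨ sumBits-suc m _ ⟩
    sumBits m (λ y → F (false ∷ y ⊕ t)) ∙ sumBits m (λ y → F (true ∷ y ⊕ t))
      ≈⟨ ∙-cong (sumBits-translate m (F ∘ (false ∷_)) t) (sumBits-translate m (F ∘ (true ∷_)) t) ⟩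
    sumBits m (F ∘ (false ∷_)) ∙ sumBits m (F ∘ (true ∷_))
      ≈⟨ sumBits-suc m F ⟨
    sumBits (suc m) F ∎
  sumBits-translate (suc m) F (true ∷ t) = begin
    sumBits (suc m) (λ y → F (y ⊕ (true ∷ t)))
      ≈⟨ sumBits-suc m _ ⟩
    sumBits m (λ y → F (true ∷ y ⊕ t)) ∙ sumBits m (λ y → F (false ∷ y ⊕ t))
      ≈⟨ ∙-cong (sumBits-translate m (F ∘ (true ∷_)) t) (sumBits-translate m (F ∘ (false ∷_)) t) ⟩
    sumBits m (F ∘ (true ∷_)) ∙ sumBits m (F ∘ (false ∷_))
      ≈⟨ comm _ _ ⟩
    sumBits m (F ∘ (false ∷_)) ∙ sumBits m (F ∘ (true ∷_))
      ≈⟨ sumBits-suc m F ⟨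
    sumBits (suc m) F ∎

  sumBits-delta : ∀ m (F : Bits m → A) y₀ → sumBits m (λ y → if does (y ≟ y₀) then F y else ε) ≈ F y₀
  sumBits-delta zero F [] = identityʳ _
  sumBits-delta (suc m) F (false ∷ y₀) = trans (sumBits-suc m _)
    (trans (∙-cong (sumBits-delta m (F ∘ (false ∷_)) y₀) (sumBits-ε m)) (identityʳ _))
  sumBits-delta (suc m) F (true ∷ y₀) = trans (sumBits-suc m _)
    (trans (∙-cong (sumBits-ε m) (sumBits-delta m (F ∘ (true ∷_)) y₀)) (identityˡ _))

module Counting where

  open import Data.Bool using (Bool; true; false; not)
  open import Relation.Nullary using (does)
  open import Relation.Unary using (Decidable)
  open import Data.List using ([]; _∷_; filter; length)
  open import Data.Nat using (ℕ; zero; suc; _+_; _*_; _^_; _≤_; s≤s; z≤n)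
  open import Data.Nat.Properties
  open import Data.Vec using ([]; _∷_)
  open import Data.Product using (_,_; ∃)
  open import Data.Sum using (_⊎_; inj₁; inj₂)
  open import Data.Empty using (⊥-elim)
  open import Function using (_∘_)
  open import Relation.Binary.PropositionalEquality
  open BitVector
  open Summation +-0-commutativeMonoid public

  bit : Bool → ℕ
  bit true = 1
  bit false = 0

  count : ∀ m → (Bits m → Bool) → ℕ
  count m P = sumBits m (bit ∘ P)

  sumBits-scale : ∀ m k (F : Bits m → ℕ) → k * sumBits m F ≡ sumBits m (λ y → k * F y)
  sumBits-scale m k F = go (allBits m)
    where
    go : ∀ xs → k * sumMap F xs ≡ sumMap (λ y → k * F y) xs
    go [] = *-zeroʳ k
    go (x ∷ xs) = trans (*-distribˡ-+ k (F x) _) (cong (k * F x +_) (go xs))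

  count-suc : ∀ m P → count (suc m) P ≡ count m (P ∘ (false ∷_)) + count m (P ∘ (true ∷_))
  count-suc m P = sumBits-suc m (bit ∘ P)

  count-cong : ∀ m {P Q : Bits m → Bool} → (∀ x → P x ≡ Q x) → count m P ≡ count m Q
  count-cong m h = sumBits-cong m (λ x → cong bit (h x))

  count-true : ∀ m → count m (λ _ → true) ≡ 2 ^ m
  count-true zero = refl
  count-true (suc m) = trans (count-suc m _)
    (trans (cong₂ _+_ (count-true m) (count-true m)) (cong (2 ^ m +_) (sym (+-identityʳ _))))

  count-false : ∀ m → count m (λ _ → false) ≡ 0
  count-false m = sumBits-ε m

  sumBits-const : ∀ m k → sumBits m (λ _ → k) ≡ k * 2 ^ m
  sumBits-const m k = trans (sumBits-cong m (λ _ → sym (*-identityʳ k)))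
    (trans (sym (sumBits-scale m k (λ _ → 1))) (cong (k *_) (count-true m)))

  count-complement : ∀ m P → count m P + count m (not ∘ P) ≡ 2 ^ m
  count-complement m P = trans (sym (sumBits-∙ m (bit ∘ P) (bit ∘ not ∘ P)))
    (trans (sumBits-cong m (λ x → bit-not (P x))) (count-true m))
    where
    bit-not : ∀ b → bit b + bit (not b) ≡ 1
    bit-not true = refl
    bit-not false = refl

  count-translate : ∀ m P t → count m (λ y → P (y ⊕ t)) ≡ count m P
  count-translate m P t = sumBits-translate m (bit ∘ P) t

  length-filter≡sumMap : ∀ {A : Set} {P : A → Set} (P? : Decidable P) xs →
                         length (filter P? xs) ≡ sumMap (bit ∘ does ∘ P?) xs
  length-filter≡sumMap P? [] = refl
  length-filter≡sumMap P? (x ∷ xs) with does (P? x)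
  ... | true = cong suc (length-filter≡sumMap P? xs)
  ... | false = length-filter≡sumMap P? xs

  count≤2^m : ∀ m P → count m P ≤ 2 ^ m
  count≤2^m m P = subst (count m P ≤_) (count-complement m P) (m≤m+n _ _)

  count≡0⊎witness : ∀ m P → count m P ≡ 0 ⊎ ∃ λ y → P y ≡ true
  count≡0⊎witness zero P with P [] in e
  ... | true = inj₂ ([] , e)
  ... | false = inj₁ refl
  count≡0⊎witness (suc m) P with count≡0⊎witness m (P ∘ (false ∷_)) | count≡0⊎witness m (P ∘ (true ∷_))
  ... | inj₂ (y , e) | _ = inj₂ (false ∷ y , e)
  ... | inj₁ _ | inj₂ (y , e) = inj₂ (true ∷ y , e)
  ... | inj₁ c₀ | inj₁ c₁ = inj₁ (trans (count-suc m P) (cong₂ _+_ c₀ c₁))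

  witness⇒1≤count : ∀ m P y → P y ≡ true → 1 ≤ count m P
  witness⇒1≤count zero P [] e rewrite e = s≤s z≤n
  witness⇒1≤count (suc m) P (false ∷ y) e = subst (1 ≤_) (sym (count-suc m P))
    (≤-trans (witness⇒1≤count m (P ∘ (false ∷_)) y e) (m≤m+n _ _))
  witness⇒1≤count (suc m) P (true ∷ y) e = subst (1 ≤_) (sym (count-suc m P))
    (≤-trans (witness⇒1≤count m (P ∘ (true ∷_)) y e) (m≤n+m _ _))

  witnesses⇒2≤count : ∀ m P y y′ → P y ≡ true → P y′ ≡ true → y ≢ y′ → 2 ≤ count m P
  witnesses⇒2≤count zero P [] [] _ _ y≢y′ = ⊥-elim (y≢y′ refl)
  witnesses⇒2≤count (suc m) P (a ∷ y) (a′ ∷ y′) e e′ y≢y′ =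
    subst (2 ≤_) (sym (count-suc m P)) (split a a′ e e′ y≢y′)
    where
    split : ∀ a a′ → P (a ∷ y) ≡ true → P (a′ ∷ y′) ≡ true → a ∷ y ≢ a′ ∷ y′ →
            2 ≤ count m (P ∘ (false ∷_)) + count m (P ∘ (true ∷_))
    split false false e e′ ne = ≤-trans
      (witnesses⇒2≤count m (P ∘ (false ∷_)) y y′ e e′ (ne ∘ cong (false ∷_))) (m≤m+n _ _)
    split true true e e′ ne = ≤-trans
      (witnesses⇒2≤count m (P ∘ (true ∷_)) y y′ e e′ (ne ∘ cong (true ∷_))) (m≤n+m _ _)
    split false true e e′ _ = +-mono-≤ (witness⇒1≤count m _ y e) (witness⇒1≤count m _ y′ e′)
    split true false e e′ _ = +-mono-≤ (witness⇒1≤count m _ y′ e′) (witness⇒1≤count m _ y e)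

module AffineCounting where

  open import Data.Bool using (Bool; true; false; not; _xor_; _∧_; if_then_else_)
  open import Data.Bool.Properties using (⇔→≡; xor-identityʳ; xor-same)
  open import Data.Nat using (ℕ; zero; suc; _+_; _^_; _<_; _≤?_; s≤s; z≤n)
  open import Data.Nat.Properties using (+-identityʳ; ^-monoʳ-<; <⇒≱; ≰⇒>; 1+n≰n; +-comm)
  open import Data.Vec using (_∷_; [])
  open import Data.Product using (∃; _×_; _,_)
  open import Data.Sum using (_⊎_; inj₁; inj₂)
  open import Data.Empty using (⊥-elim)
  open import Relation.Nullary using (yes; no)
  open import Function using (_∘_)
  open import Function.Bundles using (mk⇔)
  open import Relation.Binary.PropositionalEquality
  open BitVector
  open Counting

  Affine : ∀ m → (Bits m → Bool) → Set
  Affine m P = ∀ x y z → P x ≡ true → P y ≡ true → P z ≡ true → P (x ⊕ y ⊕ z) ≡ true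

  affine-translate : ∀ {m} P → Affine m P → ∀ {y₀ y₁} → P y₀ ≡ true → P y₁ ≡ true →
                     ∀ z → P (z ⊕ y₀ ⊕ y₁) ≡ P z
  affine-translate P aff {y₀} {y₁} e₀ e₁ z = ⇔→≡ (mk⇔ back (λ ez → aff z y₀ y₁ ez e₀ e₁))
    where
    back : P (z ⊕ y₀ ⊕ y₁) ≡ true → P z ≡ true
    back e = subst (λ w → P w ≡ true) undo (aff (z ⊕ y₀ ⊕ y₁) y₁ y₀ e e₁ e₀)
      where
      undo : z ⊕ y₀ ⊕ y₁ ⊕ y₁ ⊕ y₀ ≡ z
      undo = trans (cong (_⊕ y₀) (⊕-cancelʳ (z ⊕ y₀) y₁)) (⊕-cancelʳ z y₀)

  affine-restrict : ∀ {m} P → Affine (suc m) P → ∀ b → Affine m (P ∘ (b ∷_))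
  affine-restrict P aff false x y z = aff (false ∷ x) (false ∷ y) (false ∷ z)
  affine-restrict P aff true x y z = aff (true ∷ x) (true ∷ y) (true ∷ z)

  ZeroOrPowerOfTwo : ℕ → Set
  ZeroOrPowerOfTwo c = c ≡ 0 ⊎ ∃ λ j → c ≡ 2 ^ j

  affine-count : ∀ m P → Affine m P → ZeroOrPowerOfTwo (count m P)
  affine-count zero P _ with P []
  ... | true = inj₂ (0 , refl)
  ... | false = inj₁ refl
  affine-count (suc m) P aff
    with count≡0⊎witness m (P ∘ (false ∷_)) | count≡0⊎witness m (P ∘ (true ∷_))
  ... | inj₁ c₀ | _ = subst ZeroOrPowerOfTwo (sym (trans (count-suc m P) (cong (_+ count m (P ∘ (true ∷_))) c₀)))
                        (affine-count m (P ∘ (true ∷_)) (affine-restrict P aff true))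
  ... | inj₂ _ | inj₁ c₁ = subst ZeroOrPowerOfTwo (sym (trans (count-suc m P) (trans (cong (count m (P ∘ (false ∷_)) +_) c₁) (+-identityʳ _))))
                             (affine-count m (P ∘ (false ∷_)) (affine-restrict P aff false))
  ... | inj₂ (y₀ , e₀) | inj₂ (y₁ , e₁) =
    subst ZeroOrPowerOfTwo (sym (trans (count-suc m P) (cong (count m (P ∘ (false ∷_)) +_) halves-equal)))
      (double (affine-count m (P ∘ (false ∷_)) (affine-restrict P aff false)))
    where
    halves-equal : count m (P ∘ (true ∷_)) ≡ count m (P ∘ (false ∷_))
    halves-equal = begin
      count m (P ∘ (true ∷_))                   ≡⟨ count-cong m (λ z → sym (affine-translate P aff e₀ e₁ (true ∷ z))) ⟩
      count m (λ z → P (false ∷ (z ⊕ y₀ ⊕ y₁))) ≡⟨ count-cong m (λ z → cong (P ∘ (false ∷_)) (⊕-assoc z y₀ y₁)) ⟩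
      count m (λ z → P (false ∷ (z ⊕ (y₀ ⊕ y₁)))) ≡⟨ count-translate m (P ∘ (false ∷_)) (y₀ ⊕ y₁) ⟩
      count m (P ∘ (false ∷_))                  ∎
      where open ≡-Reasoning

    double : ∀ {c} → ZeroOrPowerOfTwo c → ZeroOrPowerOfTwo (c + c)
    double (inj₁ refl) = inj₁ refl
    double (inj₂ (j , refl)) = inj₂ (suc j , cong (2 ^ j +_) (sym (+-identityʳ _)))

  EvenPowerBelow : ℕ → ℕ → Set
  EvenPowerBelow m c = c ≡ 0 ⊎ ∃ λ i → i < m × c ≡ 2 ^ suc i

  affine-invariant-count : ∀ m P j → Affine m P → (∀ y → P y ≡ true → P (y ⊕ j) ≡ true) →
                           (∀ y → y ⊕ j ≢ y) → EvenPowerBelow m (count m P)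
  affine-invariant-count m P j aff inv fpf with affine-count m P aff
  ... | inj₁ c≡0 = inj₁ c≡0
  ... | inj₂ (suc i , c≡2^i+1) = inj₂ (i , exponent-bound , c≡2^i+1)
    where
    exponent-bound : i < m
    exponent-bound with suc i ≤? m
    ... | yes i<m = i<m
    ... | no i≮m = ⊥-elim (<⇒≱ (^-monoʳ-< 2 (s≤s (s≤s z≤n)) (≰⇒> i≮m)) (subst (_≤ 2 ^ m) c≡2^i+1 (count≤2^m m P)))
  ... | inj₂ (zero , c≡1) with count≡0⊎witness m P
  ...   | inj₁ c≡0 = inj₁ c≡0
  ...   | inj₂ (y , e) = ⊥-elim (1+n≰n (subst (2 ≤_) c≡1
                           (witnesses⇒2≤count m P y (y ⊕ j) e (inv y e) (λ y≡y⊕j → fpf y (sym y≡y⊕j)))))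

  data LevelSizes (m E₀ E₁ : ℕ) : Set where
    equal : E₀ ≡ E₁ → LevelSizes m E₀ E₁
    only₀ : ∀ {i} → i < m → E₁ ≡ 0 → E₀ ≡ 2 ^ suc i → LevelSizes m E₀ E₁
    only₁ : ∀ {i} → i < m → E₀ ≡ 0 → E₁ ≡ 2 ^ suc i → LevelSizes m E₀ E₁

  module LevelSets {m} (Q k : Bits m → Bool) where

    level : Bool → Bits m → Bool
    level b y = Q y ∧ (if b then k y else not (k y))

    level-intro : ∀ {b y} → Q y ≡ true → k y ≡ b → level b y ≡ true
    level-intro {false} q kb rewrite q | kb = refl
    level-intro {true} q kb rewrite q | kb = refl

    level-elim : ∀ {b y} → level b y ≡ true → Q y ≡ true × k y ≡ b
    level-elim {b} {y} e with Q y | k y | b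
    ... | true | true | true = refl , refl
    ... | true | false | false = refl , refl
    level-elim () | true | true | false
    level-elim () | true | false | true
    level-elim () | false | _ | _

    count-levels : count m (not ∘ Q) + (count m (level false) + count m (level true)) ≡ 2 ^ m
    count-levels = begin
      count m (not ∘ Q) + (count m (level false) + count m (level true)) ≡⟨ cong (count m (not ∘ Q) +_) split ⟩
      count m (not ∘ Q) + count m Q                                       ≡⟨ +-comm (count m (not ∘ Q)) _ ⟩
      count m Q + count m (not ∘ Q)                                       ≡⟨ count-complement m Q ⟩
      2 ^ m                                                               ∎
      where
      open ≡-Reasoning
      split : count m (level false) + count m (level true) ≡ count m Q
      split = trans (sym (sumBits-∙ m (bit ∘ level false) (bit ∘ level true))) (sumBits-cong m pointwise)
        where
        pointwise : ∀ y → bit (level false y) + bit (level true y) ≡ bit (Q y)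
        pointwise y with Q y | k y
        ... | true | true = refl
        ... | true | false = refl
        ... | false | _ = refl

    module _ (Q-affine : Affine m Q)
      (k-affine : ∀ x y z → Q x ≡ true → Q y ≡ true → Q z ≡ true → k (x ⊕ y ⊕ z) ≡ k x xor k y xor k z)
      where

      level-⊕ : ∀ {a b c x y z} → level a x ≡ true → level b y ≡ true → level c z ≡ true →
                level (a xor b xor c) (x ⊕ y ⊕ z) ≡ true
      level-⊕ {x = x} {y} {z} ex ey ez with level-elim ex | level-elim ey | level-elim ez
      ... | qx , refl | qy , refl | qz , refl = level-intro (Q-affine x y z qx qy qz) (k-affine x y z qx qy qz)

      level-affine : ∀ b → Affine m (level b)
      level-affine b x y z ex ey ez =
        subst (λ c → level c (x ⊕ y ⊕ z) ≡ true) (trans (cong (b xor_) (xor-same b)) (xor-identityʳ b))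
              (level-⊕ {b} {b} {b} ex ey ez)

      level-translate : ∀ {y₀ y₁} → level false y₀ ≡ true → level true y₁ ≡ true →
                        ∀ z → level false (z ⊕ y₀ ⊕ y₁) ≡ level true z
      level-translate {y₀} {y₁} e₀ e₁ z = ⇔→≡ (mk⇔ back (λ ez → level-⊕ ez e₀ e₁))
        where
        back : level false (z ⊕ y₀ ⊕ y₁) ≡ true → level true z ≡ true
        back e = subst (λ w → level true w ≡ true) undo (level-⊕ e e₁ e₀)
          where
          undo : z ⊕ y₀ ⊕ y₁ ⊕ y₁ ⊕ y₀ ≡ z
          undo = trans (cong (_⊕ y₀) (⊕-cancelʳ (z ⊕ y₀) y₁)) (⊕-cancelʳ z y₀)

      level-invariant : ∀ j → (∀ y → Q y ≡ true → Q (y ⊕ j) ≡ true × k (y ⊕ j) ≡ k y) →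
                        ∀ b y → level b y ≡ true → level b (y ⊕ j) ≡ true
      level-invariant j inv b y e with level-elim e
      ... | q , kb with inv y q
      ...   | q′ , k′ = level-intro q′ (trans k′ kb)

      level-sizes : ∀ j → (∀ y → Q y ≡ true → Q (y ⊕ j) ≡ true × k (y ⊕ j) ≡ k y) → (∀ y → y ⊕ j ≢ y) →
                    LevelSizes m (count m (level false)) (count m (level true))
      level-sizes j inv fpf with count≡0⊎witness m (level false) | count≡0⊎witness m (level true)
      ... | inj₂ (y₀ , e₀) | inj₂ (y₁ , e₁) = equal (begin
        count m (level false)                        ≡⟨ count-translate m (level false) (y₀ ⊕ y₁) ⟨
        count m (λ z → level false (z ⊕ (y₀ ⊕ y₁))) ≡⟨ count-cong m (λ z → cong (level false) (⊕-assoc z y₀ y₁)) ⟨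
        count m (λ z → level false (z ⊕ y₀ ⊕ y₁))   ≡⟨ count-cong m (level-translate e₀ e₁) ⟩
        count m (level true)                         ∎)
        where open ≡-Reasoning
      ... | inj₁ c₀ | inj₁ c₁ = equal (trans c₀ (sym c₁))
      ... | inj₁ c₀ | inj₂ _ with affine-invariant-count m (level true) j (level-affine true) (level-invariant j inv true) fpf
      ...   | inj₁ c₁ = equal (trans c₀ (sym c₁))
      ...   | inj₂ (i , i<m , c₁) = only₁ i<m c₀ c₁
      level-sizes j inv fpf | inj₂ _ | inj₁ c₁
        with affine-invariant-count m (level false) j (level-affine false) (level-invariant j inv false) fpf
      ...   | inj₁ c₀ = equal (trans c₀ (sym c₁))
      ...   | inj₂ (i , i<m , c₀) = only₀ i<m c₁ c₀

module LinearCounting where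

  open import Data.Bool using (Bool; true; false; not; _xor_; _∧_)
  open import Data.Bool.Properties using (xor-comm; xor-identityʳ; true-xor)
  open import Data.Nat using (ℕ; zero; suc; _+_; _*_; _^_)
  open import Data.Nat.Properties using (*-distribˡ-+; +-identityʳ; +-comm; +-cancelˡ-≡)
  open import Data.Nat.Tactic.RingSolver using (solve-∀)
  open import Data.Vec using ([]; _∷_)
  open import Data.Product using (_×_; _,_)
  open import Relation.Nullary using (does; yes; Dec)
  open import Relation.Nullary.Decidable using (does-⇔; dec-true; ¬?)
  open import Function.Bundles using (_⇔_; mk⇔)
  import Data.Bool as Bool
  import Data.Fin as Fin
  open import Function using (_∘_)
  open import Relation.Binary.PropositionalEquality
  open BitVector
  open Counting

  isZero : ∀ {m} → Bits m → Bool
  isZero a = does (a ≟ 𝟘 _)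

  2*count-dot : ∀ m (a : Bits m) → isZero a ≡ false → 2 * count m (λ x → dot x a) ≡ 2 ^ m
  2*count-dot zero [] ()
  2*count-dot (suc m) (false ∷ a) a≢𝟘 = begin
    2 * count (suc m) (λ x → dot x (false ∷ a)) ≡⟨ cong (2 *_) (count-suc m _) ⟩
    2 * (c + c)                                  ≡⟨ *-distribˡ-+ 2 c c ⟩
    2 * c + 2 * c                                ≡⟨ cong₂ _+_ ih ih ⟩
    2 ^ m + 2 ^ m                                ≡⟨ cong (2 ^ m +_) (+-identityʳ _) ⟨
    2 ^ suc m                                    ∎
    where
    open ≡-Reasoning
    c = count m (λ x → dot x a)
    ih = 2*count-dot m a a≢𝟘
  2*count-dot (suc m) (true ∷ a) _ =
    cong (2 *_) (trans (count-suc m _) (count-complement m (λ x → dot x a)))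

  2*count-dot-xor : ∀ m (b : Bits m) κ → isZero b ≡ false → 2 * count m (λ x → dot x b xor κ) ≡ 2 ^ m
  2*count-dot-xor m b false b≢𝟘 =
    trans (cong (2 *_) (count-cong m (λ x → xor-identityʳ (dot x b)))) (2*count-dot m b b≢𝟘)
  2*count-dot-xor m b true b≢𝟘 = +-cancelˡ-≡ (2 * c) _ _ (begin
    2 * c + 2 * count m (λ x → dot x b xor true) ≡⟨ cong (λ c′ → 2 * c + 2 * c′) (count-cong m (λ x → trans (xor-comm _ true) (true-xor _))) ⟩
    2 * c + 2 * count m (not ∘ (λ x → dot x b))  ≡⟨ *-distribˡ-+ 2 c _ ⟨
    2 * (c + count m (not ∘ (λ x → dot x b)))    ≡⟨ cong (2 *_) (count-complement m _) ⟩
    2 * 2 ^ m                                    ≡⟨ cong (2 ^ m +_) (+-identityʳ _) ⟩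
    2 ^ m + 2 ^ m                                ≡⟨ cong (_+ 2 ^ m) (2*count-dot m b b≢𝟘) ⟨
    2 * c + 2 ^ m                                ∎)
    where
    open ≡-Reasoning
    c = count m (λ x → dot x b)

  isZero-true : ∀ {m} (a : Bits m) → isZero a ≡ true → a ≡ 𝟘 m
  isZero-true a e with a ≟ 𝟘 _
  ... | yes a≡𝟘 = a≡𝟘

  isZero-𝟘 : ∀ m → isZero (𝟘 m) ≡ true
  isZero-𝟘 m = dec-true (𝟘 m ≟ 𝟘 m) refl

  isZero-⊕ : ∀ {m} (a b : Bits m) → isZero (a ⊕ b) ≡ does (a ≟ b)
  isZero-⊕ a b = does-⇔ (mk⇔ (x⊕y≡𝟘⇒x≡y a b) (λ a≡b → trans (cong (a ⊕_) (sym a≡b)) (⊕-self a))) (a ⊕ b ≟ 𝟘 _) (a ≟ b)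

  2*count-dot-xor-formula : ∀ m (b : Bits m) κ →
    2 * count m (λ x → dot x b xor κ) ≡ 2 ^ m * bit (not (isZero b)) + 2 * 2 ^ m * bit (isZero b ∧ κ)
  2*count-dot-xor-formula m b κ with isZero b in e
  ... | false = trans (2*count-dot-xor m b κ e) (p≡p*1+2p*0 (2 ^ m))
    where
    p≡p*1+2p*0 : ∀ p → p ≡ p * 1 + 2 * p * 0
    p≡p*1+2p*0 = solve-∀
  ... | true = trans (cong (2 *_) (count-cong m (λ x → cong (_xor κ) (dot-𝟘 x)))) (constant κ)
    where
    dot-𝟘 : ∀ x → dot x b ≡ false
    dot-𝟘 x = trans (cong (dot x) (isZero-true b e)) (dot-zeroʳ x)
    2p≡p*0+2p*1 : ∀ p → 2 * p ≡ p * 0 + 2 * p * 1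
    2p≡p*0+2p*1 = solve-∀
    0≡p*0+2p*0 : ∀ p → 0 ≡ p * 0 + 2 * p * 0
    0≡p*0+2p*0 = solve-∀
    constant : ∀ κ → 2 * count m (λ _ → κ) ≡ 2 ^ m * 0 + 2 * 2 ^ m * bit κ
    constant true = trans (cong (2 *_) (count-true m)) (2p≡p*0+2p*1 (2 ^ m))
    constant false = trans (cong (2 *_) (count-false m)) (0≡p*0+2p*0 (2 ^ m))

  countPairs : ∀ m → (Bits m × Bits m → Bool) → ℕ
  countPairs m D = sumMap (bit ∘ D) (allPairs m)

  2*countPairs-formula : ∀ m (a : Bits m → Bits m) (k : Bits m → Bool) →
    2 * countPairs m (λ (x , y) → dot x (a y) xor k y)
    ≡ 2 ^ m * count m (not ∘ isZero ∘ a) + 2 * 2 ^ m * count m (λ y → isZero (a y) ∧ k y)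
  2*countPairs-formula m a k = begin
    2 * countPairs m D
      ≡⟨ cong (2 *_) (trans (sumPairs m (bit ∘ D)) (sumBits-swap m m (λ x y → bit (D (x , y))))) ⟩
    2 * sumBits m (λ y → count m (λ x → dot x (a y) xor k y))
      ≡⟨ sumBits-scale m 2 _ ⟩
    sumBits m (λ y → 2 * count m (λ x → dot x (a y) xor k y))
      ≡⟨ sumBits-cong m (λ y → 2*count-dot-xor-formula m (a y) (k y)) ⟩
    sumBits m (λ y → 2 ^ m * bit (not (isZero (a y))) + 2 * 2 ^ m * bit (isZero (a y) ∧ k y))
      ≡⟨ sumBits-∙ m _ _ ⟩
    sumBits m (λ y → 2 ^ m * bit (not (isZero (a y)))) + sumBits m (λ y → 2 * 2 ^ m * bit (isZero (a y) ∧ k y))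
      ≡⟨ cong₂ _+_ (sumBits-scale m (2 ^ m) _) (sumBits-scale m (2 * 2 ^ m) _) ⟨
    2 ^ m * count m (not ∘ isZero ∘ a) + 2 * 2 ^ m * count m (λ y → isZero (a y) ∧ k y) ∎
    where
    open ≡-Reasoning
    D : Bits m × Bits m → Bool
    D (x , y) = dot x (a y) xor k y

  countPairs-cong : ∀ m {D D′ : Bits m × Bits m → Bool} → (∀ xy → D xy ≡ D′ xy) → countPairs m D ≡ countPairs m D′
  countPairs-cong m h = sumMap-cong (λ xy → cong bit (h xy)) (allPairs m)

  distH≡countPairs : ∀ {m q} (f₁ f₂ : Fn m q) (D : Bits m × Bits m → Bool) →
                     (∀ x y → does (¬? (f₁ x y Fin.≟ f₂ x y)) ≡ D (x , y)) → distH f₁ f₂ ≡ countPairs m D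
  distH≡countPairs {m} f₁ f₂ D h = trans (length-filter≡sumMap _ (allPairs m)) (countPairs-cong m (λ (x , y) → h x y))

  not-does≡xor : ∀ {A : Set} {a b : A} (a≟b : Dec (a ≡ b)) {u v} → (a ≡ b ⇔ u ≡ v) → not (does a≟b) ≡ u xor v
  not-does≡xor a≟b {u} {v} a≡b⇔u≡v = trans (cong not (does-⇔ a≡b⇔u≡v a≟b (u Bool.≟ v))) (lemma u v)
    where
    lemma : ∀ u v → not (does (u Bool.≟ v)) ≡ u xor v
    lemma false false = refl
    lemma false true = refl
    lemma true false = refl
    lemma true true = refl

  countPairs-true : ∀ m → countPairs m (λ _ → true) ≡ 2 ^ m * 2 ^ m
  countPairs-true m = trans (sumPairs m _) (trans (sumBits-cong m (λ _ → count-true m)) (sumBits-const m (2 ^ m)))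

  countPairs-complement : ∀ m D → countPairs m (not ∘ D) + countPairs m D ≡ 2 ^ m * 2 ^ m
  countPairs-complement m D = begin
    countPairs m (not ∘ D) + countPairs m D
      ≡⟨ cong₂ _+_ (sumPairs m (bit ∘ not ∘ D)) (sumPairs m (bit ∘ D)) ⟩
    sumBits m (λ x → count m (λ y → not (D (x , y)))) + sumBits m (λ x → count m (λ y → D (x , y)))
      ≡⟨ sumBits-∙ m _ _ ⟨
    sumBits m (λ x → count m (λ y → not (D (x , y))) + count m (λ y → D (x , y)))
      ≡⟨ sumBits-cong m (λ x → trans (+-comm (count m (λ y → not (D (x , y)))) _) (count-complement m (λ y → D (x , y)))) ⟩
    sumBits m (λ _ → 2 ^ m)
      ≡⟨ sumBits-const m (2 ^ m) ⟩
    2 ^ m * 2 ^ m ∎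
    where open ≡-Reasoning

module Rotation where

  open import Data.Bool using (Bool; true; false; _xor_; _∧_)
  open import Data.Nat using (ℕ; zero; suc; _+_; _^_; _∸_; _≤_; s≤s)
  open import Data.Nat.Properties using (+-identityʳ)
  open import Data.Vec using ([]; _∷_; head; tail)
  open import Relation.Nullary using (does)
  open import Data.Bool.Solver using (module xor-∧-Solver)
  open xor-∧-Solver using (_:+_; _:=_; solve)
  open import Relation.Binary.PropositionalEquality
  open BitVector
  open Counting using (count; count-suc; count-false; count-cong; count-true)

  -- rot t moves the first coordinate t places to the right: a (t+1)-cycle of coordinates.
  rot : ℕ → ∀ {m} → Bits m → Bits m
  rot zero v = v
  rot (suc t) [] = []
  rot (suc t) (a ∷ []) = a ∷ []
  rot (suc t) (a ∷ b ∷ v) = b ∷ rot t (a ∷ v)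

  unrot : ℕ → ∀ {m} → Bits m → Bits m
  unrot zero v = v
  unrot (suc t) [] = []
  unrot (suc t) (a ∷ []) = a ∷ []
  unrot (suc t) (b ∷ c ∷ w) = head (unrot t (c ∷ w)) ∷ b ∷ tail (unrot t (c ∷ w))

  unrot-rot : ∀ t {m} (v : Bits m) → unrot t (rot t v) ≡ v
  unrot-rot zero v = refl
  unrot-rot (suc t) [] = refl
  unrot-rot (suc t) (a ∷ []) = refl
  unrot-rot (suc t) (a ∷ b ∷ v) with rot t (a ∷ v) in e
  ... | c ∷ w = cong₂ (λ x y → x ∷ b ∷ y) (cong head ih) (cong tail ih)
    where
    ih : unrot t (c ∷ w) ≡ a ∷ v
    ih = trans (cong (unrot t) (sym e)) (unrot-rot t (a ∷ v))

  rot-unrot : ∀ t {m} (v : Bits m) → rot t (unrot t v) ≡ v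
  rot-unrot zero v = refl
  rot-unrot (suc t) [] = refl
  rot-unrot (suc t) (a ∷ []) = refl
  rot-unrot (suc t) (b ∷ c ∷ w) with unrot t (c ∷ w) in e
  ... | d ∷ u = cong (b ∷_) (trans (cong (rot t) (sym e)) (rot-unrot t (c ∷ w)))

  dot-rot : ∀ t {m} (u v : Bits m) → dot u (rot t v) ≡ dot (unrot t u) v
  dot-rot zero u v = refl
  dot-rot (suc t) [] [] = refl
  dot-rot (suc t) (b ∷ []) (a ∷ []) = refl
  dot-rot (suc t) (b ∷ c ∷ w) (a ∷ a′ ∷ v) with unrot t (c ∷ w) in e
  ... | d ∷ u = trans (cong ((b ∧ a′) xor_) (trans (dot-rot t (c ∷ w) (a ∷ v)) (cong (λ z → dot z (a ∷ v)) e)))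
                      (swap (b ∧ a′) (d ∧ a) (dot u v))
    where
    swap : ∀ x y z → x xor (y xor z) ≡ y xor (x xor z)
    swap = solve 3 (λ x y z → x :+ (y :+ z) := y :+ (x :+ z)) refl

  rot-isometry : ∀ t {m} (x y : Bits m) → dot (rot t x) (rot t y) ≡ dot x y
  rot-isometry t x y = trans (dot-rot t (rot t x) y) (cong (λ z → dot z y) (unrot-rot t x))

  fixed-points : ℕ → ∀ m → Bits m → Bool
  fixed-points t m y = does (y ≟ rot t y)

  count-fixed-points : ∀ t k → t ≤ k → count (suc k) (fixed-points t (suc k)) ≡ 2 ^ suc (k ∸ t)
  count-fixed-points zero k _ = trans (count-cong (suc k) (λ y → dec-true (y ≟ y) refl)) (count-true (suc k))
    where open import Relation.Nullary.Decidable using (dec-true)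
  count-fixed-points (suc t) (suc k) (s≤s t≤k) = trans step (count-fixed-points t k t≤k)
    where
    open ≡-Reasoning
    F : Bool → Bits k → Bool
    F b v = fixed-points t (suc k) (b ∷ v)
    step : count (suc (suc k)) (fixed-points (suc t) (suc (suc k))) ≡ count (suc k) (fixed-points t (suc k))
    step = begin
      count (suc (suc k)) (fixed-points (suc t) (suc (suc k)))
        ≡⟨ count-suc (suc k) _ ⟩
      count (suc k) (λ y → fixed-points (suc t) _ (false ∷ y)) + count (suc k) (λ y → fixed-points (suc t) _ (true ∷ y))
        ≡⟨ cong₂ _+_ (count-suc k _) (count-suc k _) ⟩
      (count k (F false) + count k (λ _ → false)) + (count k (λ _ → false) + count k (F true))
        ≡⟨ cong₂ (λ z z′ → (count k (F false) + z) + (z′ + count k (F true))) (count-false k) (count-false k) ⟩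
      (count k (F false) + 0) + count k (F true)
        ≡⟨ cong (_+ count k (F true)) (+-identityʳ _) ⟩
      count k (F false) + count k (F true)
        ≡⟨ count-suc k _ ⟨
      count (suc k) (fixed-points t (suc k)) ∎

module TargetArithmetic where

  open import Data.Nat using (ℕ; suc; _+_; _*_; _^_; _∸_; _≤_; _<_; s≤s; z≤n)
  open import Data.Nat.Properties
    using (+-identityʳ; +-cancelʳ-≡; *-cancelˡ-≡; ^-distribˡ-+-*; *-zeroʳ; *-distribˡ-+; m∸n≤m; m+n∸n≡m; m∸n+n≡m; m+n∸m≡n; *-assoc; +-assoc)
  open import Data.Nat.Tactic.RingSolver using (solve-∀)
  open import Data.Product using (_,_)
  open import Data.Sum using (inj₁; inj₂)
  open import Relation.Binary.PropositionalEquality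
  open AffineCounting using (LevelSizes; equal; only₀; only₁)

  centre : ℕ → ℕ
  centre m = 2 ^ (2 * m ∸ 1)

  offset : ℕ → ℕ → ℕ
  offset m r = 2 ^ (2 * m ∸ 1 ∸ r)

  -- InTarget with the subtraction moved to the other side, so that no truncated subtraction occurs.
  data Shape (m d : ℕ) : Set where
    centred : d ≡ centre m → Shape m d
    below : ∀ {r} → r < m → d + offset m r ≡ centre m → Shape m d
    above : ∀ {r} → r < m → d ≡ centre m + offset m r → Shape m d

  shape⇒target : ∀ {m d} → Shape m d → InTarget m d
  shape⇒target (centred d≡c) = inj₁ d≡c
  shape⇒target {m} {d} (below {r} r<m e) = inj₂ (r , r<m , inj₂ (trans (sym (m+n∸n≡m d (offset m r))) (cong (_∸ offset m r) e)))
  shape⇒target (above {r} r<m e) = inj₂ (r , r<m , inj₁ e)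

  2*centre : ∀ m′ → 2 * centre (suc m′) ≡ 2 ^ suc m′ * 2 ^ suc m′
  2*centre m′ = trans (^-distribˡ-+-* 2 (suc m′) (suc m′ + 0)) (cong (λ n → 2 ^ suc m′ * 2 ^ n) (+-identityʳ (suc m′)))

  2*offset : ∀ m′ i → i ≤ m′ → 2 * offset (suc m′) (m′ ∸ i) ≡ 2 ^ suc m′ * 2 ^ suc i
  2*offset m′ i i≤m′ = begin
    2 * 2 ^ (m′ + (suc m′ + 0) ∸ u)    ≡⟨ cong (λ n → 2 * 2 ^ n) exponent ⟩
    2 * 2 ^ (m′ + suc i)               ≡⟨ cong (2 *_) (^-distribˡ-+-* 2 m′ (suc i)) ⟩
    2 * (2 ^ m′ * 2 ^ suc i)           ≡⟨ *-assoc 2 (2 ^ m′) (2 ^ suc i) ⟨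
    2 ^ suc m′ * 2 ^ suc i             ∎
    where
    open ≡-Reasoning
    u = m′ ∸ i
    u+i≡m′ : u + i ≡ m′
    u+i≡m′ = m∸n+n≡m i≤m′
    regroup : ∀ u i → u + i + (suc (u + i) + 0) ≡ u + (i + suc (u + i))
    regroup = solve-∀
    reorder : ∀ u i → i + suc (u + i) ≡ u + i + suc i
    reorder = solve-∀
    exponent : m′ + (suc m′ + 0) ∸ u ≡ m′ + suc i
    exponent = begin
      m′ + (suc m′ + 0) ∸ u              ≡⟨ cong (λ n → n + (suc n + 0) ∸ u) u+i≡m′ ⟨
      u + i + (suc (u + i) + 0) ∸ u      ≡⟨ cong (_∸ u) (regroup u i) ⟩
      u + (i + suc (u + i)) ∸ u          ≡⟨ m+n∸m≡n u _ ⟩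
      i + suc (u + i)                    ≡⟨ reorder u i ⟩
      u + i + suc i                      ≡⟨ cong (_+ suc i) u+i≡m′ ⟩
      m′ + suc i                         ∎

  module _ (m′ : ℕ) where

    private
      m = suc m′
      M = 2 ^ m

    module _ {pc Z E₀ E₁ : ℕ} (2pc≡ : 2 * pc ≡ M * Z + 2 * M * E₁) (Z+E≡M : Z + (E₀ + E₁) ≡ M) where

      private
        regroup : ∀ M Z E₀ E₁ → M * Z + 2 * M * E₁ + M * E₀ ≡ M * (Z + (E₀ + E₁)) + M * E₁
        regroup = solve-∀
        key : 2 * pc + M * E₀ ≡ M * M + M * E₁
        key = trans (cong (_+ M * E₀) 2pc≡) (trans (regroup M Z E₀ E₁) (cong (λ n → M * n + M * E₁) Z+E≡M))

      centred-from-levels : E₀ ≡ E₁ → pc ≡ centre m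
      centred-from-levels refl = *-cancelˡ-≡ pc (centre m) 2
        (trans (+-cancelʳ-≡ (M * E₀) _ _ key) (sym (2*centre m′)))

      below-from-levels : ∀ {i} → i ≤ m′ → E₁ ≡ 0 → E₀ ≡ 2 ^ suc i → pc + offset m (m′ ∸ i) ≡ centre m
      below-from-levels {i} i≤m′ refl refl = *-cancelˡ-≡ _ (centre m) 2 (begin
        2 * (pc + offset m (m′ ∸ i))         ≡⟨ *-distribˡ-+ 2 pc _ ⟩
        2 * pc + 2 * offset m (m′ ∸ i)       ≡⟨ cong (2 * pc +_) (2*offset m′ i i≤m′) ⟩
        2 * pc + M * 2 ^ suc i               ≡⟨ key ⟩
        M * M + M * 0                        ≡⟨ trans (cong (M * M +_) (*-zeroʳ M)) (+-identityʳ _) ⟩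
        M * M                                ≡⟨ 2*centre m′ ⟨
        2 * centre m                         ∎)
        where open ≡-Reasoning

      above-from-levels : ∀ {i} → i ≤ m′ → E₀ ≡ 0 → E₁ ≡ 2 ^ suc i → pc ≡ centre m + offset m (m′ ∸ i)
      above-from-levels {i} i≤m′ refl refl = *-cancelˡ-≡ pc _ 2 (begin
        2 * pc                               ≡⟨ +-identityʳ _ ⟨
        2 * pc + 0                           ≡⟨ cong (2 * pc +_) (*-zeroʳ M) ⟨
        2 * pc + M * 0                       ≡⟨ key ⟩
        M * M + M * 2 ^ suc i                ≡⟨ cong₂ _+_ (2*centre m′) (2*offset m′ i i≤m′) ⟨
        2 * centre m + 2 * offset m (m′ ∸ i) ≡⟨ *-distribˡ-+ 2 (centre m) _ ⟨
        2 * (centre m + offset m (m′ ∸ i))   ∎)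
        where open ≡-Reasoning

      shape-from-levels : LevelSizes m E₀ E₁ → Shape m pc
      shape-from-levels (equal e) = centred (centred-from-levels e)
      shape-from-levels (only₀ {i} (s≤s i≤m′) e₁ e₀) = below (s≤s (m∸n≤m m′ i)) (below-from-levels i≤m′ e₁ e₀)
      shape-from-levels (only₁ {i} (s≤s i≤m′) e₀ e₁) = above (s≤s (m∸n≤m m′ i)) (above-from-levels i≤m′ e₀ e₁)

    private
      M*M≡c+c : M * M ≡ centre m + centre m
      M*M≡c+c = trans (sym (2*centre m′)) (cong (centre m +_) (+-identityʳ _))

    module _ {d pc : ℕ} (d+pc≡M*M : d + pc ≡ M * M) where

      private
        d+pc≡c+c : d + pc ≡ centre m + centre m
        d+pc≡c+c = trans d+pc≡M*M M*M≡c+c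

      complement-centre : pc ≡ centre m → d ≡ centre m
      complement-centre pc≡c = +-cancelʳ-≡ pc d _ (trans d+pc≡c+c (cong (centre m +_) (sym pc≡c)))

      complement-below : ∀ {o} → pc + o ≡ centre m → d ≡ centre m + o
      complement-below {o} pc+o≡c = +-cancelʳ-≡ pc d _ (begin
        d + pc             ≡⟨ d+pc≡c+c ⟩
        c + c              ≡⟨ cong (c +_) pc+o≡c ⟨
        c + (pc + o)       ≡⟨ swap c pc o ⟩
        c + o + pc         ∎)
        where
        open ≡-Reasoning
        c = centre m
        swap : ∀ c p o → c + (p + o) ≡ c + o + p
        swap = solve-∀

      complement-above : ∀ {o} → pc ≡ centre m + o → d + o ≡ centre m
      complement-above {o} pc≡c+o = +-cancelʳ-≡ pc _ c (begin
        d + o + pc         ≡⟨ swap d o pc ⟩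
        d + pc + o         ≡⟨ cong (_+ o) d+pc≡c+c ⟩
        c + c + o          ≡⟨ +-assoc c c o ⟩
        c + (c + o)        ≡⟨ cong (c +_) pc≡c+o ⟨
        c + pc             ∎)
        where
        open ≡-Reasoning
        c = centre m
        swap : ∀ d o p → d + o + p ≡ d + p + o
        swap = solve-∀

      shape-complement : Shape m pc → Shape m d
      shape-complement (centred pc≡c) = centred (complement-centre pc≡c)
      shape-complement (below r<m pc+o≡c) = above r<m (complement-below pc+o≡c)
      shape-complement (above r<m pc≡c+o) = below r<m (complement-above pc≡c+o)

    shape-full : ∀ d → d ≡ M * M → Shape m d
    shape-full d d≡M*M = above (s≤s z≤n) (trans d≡M*M M*M≡c+c)

module RingIdentities {c ℓ} (R : CommutativeRing c ℓ) where

  open import Data.Maybe using (nothing)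
  open import Tactic.RingSolver using (solve-∀)
  open import Tactic.RingSolver.Core.AlmostCommutativeRing using (AlmostCommutativeRing; fromCommutativeRing)

  almostCommutativeRing : AlmostCommutativeRing c ℓ
  almostCommutativeRing = fromCommutativeRing R (λ _ → nothing)

  open AlmostCommutativeRing almostCommutativeRing

  foil : ∀ z s o → (z + s) * (z + o) ≈ z * z + s * o + (z * o + s * z)
  foil = solve-∀ almostCommutativeRing

module Characters {c ℓ} (R : CommutativeRing c ℓ) where

  open CommutativeRing R
  open Walsh R public
  open import Data.Bool using (true; false; not; _xor_; if_then_else_)
  open import Data.Bool.Properties using (xor-same)
  open import Data.Nat as ℕ using (ℕ; zero; suc; _^_)
  import Data.Nat.Properties as ℕ
  open import Data.Vec using ([]; _∷_)
  open import Data.List using ([]; _∷_)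
  import Relation.Binary.PropositionalEquality as ≡
  open import Relation.Binary.Reasoning.Setoid setoid
  open import Algebra.Properties.Ring ring using (-1*x≈-x; -‿involutive; -‿distribʳ-*)
  open BitVector
  open LinearCounting using (isZero)
  open Summation +-commutativeMonoid public

  pow-+ : ∀ a i j → pow a (i ℕ.+ j) ≈ pow a i * pow a j
  pow-+ a zero j = sym (*-identityˡ _)
  pow-+ a (suc i) j = trans (*-congˡ (pow-+ a i j)) (sym (*-assoc _ _ _))

  fromℕ-+ : ∀ i j → fromℕ (i ℕ.+ j) ≈ fromℕ i + fromℕ j
  fromℕ-+ zero j = sym (+-identityˡ _)
  fromℕ-+ (suc i) j = trans (+-congˡ (fromℕ-+ i j)) (sym (+-assoc _ _ _))

  sign-xor : ∀ a b → sign (a xor b) ≈ sign a * sign b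
  sign-xor false b = sym (*-identityˡ _)
  sign-xor true false = sym (*-identityʳ _)
  sign-xor true true = begin
    1#             ≈⟨ -‿involutive 1# ⟨
    - (- 1#)       ≈⟨ -‿cong (-1*x≈-x 1#) ⟨
    - (- 1# * 1#)  ≈⟨ -‿distribʳ-* _ _ ⟩
    - 1# * - 1#    ∎

  sign-square : ∀ a → sign a * sign a ≈ 1#
  sign-square a = trans (sym (sign-xor a a)) (reflexive (≡.cong sign (xor-same a)))

  sign-transfer : ∀ a b {x y} → sign a * x ≈ sign b * y → x ≈ sign (a xor b) * y
  sign-transfer a b {x} {y} e = begin
    x                          ≈⟨ *-identityˡ x ⟨
    1# * x                     ≈⟨ *-congʳ (sign-square a) ⟨
    (sign a * sign a) * x      ≈⟨ *-assoc _ _ _ ⟩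
    sign a * (sign a * x)      ≈⟨ *-congˡ e ⟩
    sign a * (sign b * y)      ≈⟨ *-assoc _ _ _ ⟨
    (sign a * sign b) * y      ≈⟨ *-congʳ (sign-xor a b) ⟨
    sign (a xor b) * y         ∎

  sign-not : ∀ a → sign (not a) ≈ - sign a
  sign-not false = refl
  sign-not true = sym (-‿involutive 1#)

  sumBits-scale : ∀ m a (F : Bits m → Carrier) → a * sumBits m F ≈ sumBits m (λ y → a * F y)
  sumBits-scale m a F = go (allBits m)
    where
    go : ∀ xs → a * sumMap F xs ≈ sumMap (λ y → a * F y) xs
    go [] = zeroʳ a
    go (x ∷ xs) = trans (distribˡ a (F x) _) (+-congˡ (go xs))

  sumBits-neg : ∀ m (F : Bits m → Carrier) → sumBits m (λ y → - F y) ≈ - sumBits m F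
  sumBits-neg m F =
    trans (sumBits-cong m (λ y → sym (-1*x≈-x (F y)))) (trans (sym (sumBits-scale m (- 1#) F)) (-1*x≈-x _))

  character-sum : ∀ m (a : Bits m) → sumBits m (λ x → sign (dot x a)) ≈ (if isZero a then fromℕ (2 ^ m) else 0#)
  character-sum zero [] = refl
  character-sum (suc m) (false ∷ a) = trans (sumBits-suc m _) (doubled (isZero a) (character-sum m a))
    where
    doubled : ∀ b {S} → S ≈ (if b then fromℕ (2 ^ m) else 0#) →
              S + S ≈ (if b then fromℕ (2 ^ suc m) else 0#)
    doubled true e = trans (+-cong e e) (trans (sym (fromℕ-+ (2 ^ m) (2 ^ m)))
                       (reflexive (≡.cong (λ n → fromℕ (2 ^ m ℕ.+ n)) (≡.sym (ℕ.+-identityʳ _)))))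
    doubled false e = trans (+-cong e e) (+-identityˡ 0#)
  character-sum (suc m) (true ∷ a) = begin
    sumBits (suc m) (λ x → sign (dot x (true ∷ a)))          ≈⟨ sumBits-suc m _ ⟩
    S + sumBits m (λ x → sign (not (dot x a)))                ≈⟨ +-congˡ (sumBits-cong m (λ x → sign-not (dot x a))) ⟩
    S + sumBits m (λ x → - sign (dot x a))                    ≈⟨ +-congˡ (sumBits-neg m _) ⟩
    S + - S                                                   ≈⟨ -‿inverseʳ S ⟩
    0#                                                        ∎
    where
    S = sumBits m (λ x → sign (dot x a))

  module Cyclotomic (q : ℕ) {{_ : NonZero q}} (2∣q : 2 ∣ q) (ω : Carrier) (CS : CyclotomicSetting q ω) where

    open CyclotomicSetting CS
    open import Data.Nat using (_∸_; _/_; _≤_; _<_; z≤n; s≤s)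
    open import Data.Nat.DivMod using (_mod_; _%_; m%n<n; m*n/n≡m; m≡m%n+[m/n]*n)
    open import Data.Nat.Divisibility using (divides)
    open import Data.Fin using (Fin; toℕ)
    open import Data.Fin.Properties using (toℕ-injective; toℕ<n; toℕ-fromℕ<)
    open import Data.Sum using (_⊎_; inj₁; inj₂)
    open import Data.Empty using (⊥-elim)
    open import Relation.Nullary using (¬_)
    open import Algebra.Properties.Ring ring using (x[y-z]≈xy-xz)
    open RingIdentities R

    ω^_ : ℕ → Carrier
    ω^ k = pow ω k

    half : ℕ
    half = q / 2

    half+half≡q : half ℕ.+ half ≡.≡ q
    half+half≡q = from-divides 2∣q
      where
      from-divides : 2 ∣ q → half ℕ.+ half ≡.≡ q
      from-divides (divides k q≡k*2) =
        ≡.trans (≡.cong (λ h → h ℕ.+ h) half≡k) (≡.trans (k+k≡k*2 k) (≡.sym q≡k*2))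
        where
        half≡k : half ≡.≡ k
        half≡k = ≡.trans (≡.cong (_/ 2) q≡k*2) (m*n/n≡m k 2)
        k+k≡k*2 : ∀ k → k ℕ.+ k ≡.≡ k ℕ.* 2
        k+k≡k*2 k = ≡.trans (≡.cong (k ℕ.+_) (≡.sym (ℕ.+-identityʳ k))) (ℕ.*-comm 2 k)

    x-y≈0⇒x≈y : ∀ {x y} → x + - y ≈ 0# → x ≈ y
    x-y≈0⇒x≈y {x} {y} e = begin
      x              ≈⟨ +-identityʳ x ⟨
      x + 0#         ≈⟨ +-congˡ (-‿inverseˡ y) ⟨
      x + (- y + y)  ≈⟨ +-assoc _ _ _ ⟨
      (x + - y) + y  ≈⟨ +-congʳ e ⟩
      0# + y         ≈⟨ +-identityˡ y ⟩
      y              ∎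

    *-cancelˡ : ∀ {a x y} → ¬ (a ≈ 0#) → a * x ≈ a * y → x ≈ y
    *-cancelˡ {a} {x} {y} a≉0 e with noZeroDivisor a (x + - y) (trans (x[y-z]≈xy-xz a x y) (trans (+-congʳ e) (-‿inverseʳ _)))
    ... | inj₁ a≈0 = ⊥-elim (a≉0 a≈0)
    ... | inj₂ x-y≈0 = x-y≈0⇒x≈y x-y≈0

    *-cancelʳ : ∀ {a x y} → ¬ (a ≈ 0#) → x * a ≈ y * a → x ≈ y
    *-cancelʳ {a} {x} {y} a≉0 e = *-cancelˡ a≉0 (trans (*-comm a x) (trans e (*-comm y a)))

    2^m≉0 : ∀ m → ¬ (fromℕ (2 ^ m) ≈ 0#)
    2^m≉0 m e = ℕ.<⇒≢ (ℕ.m^n>0 2 m) (≡.sym (charZero _ e))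

    1≉-1 : ¬ (1# ≈ - 1#)
    1≉-1 e with charZero 2 (trans (+-congˡ (+-identityʳ 1#)) (trans (+-congˡ e) (-‿inverseʳ 1#)))
    ... | ()

    sign-injective : ∀ {a b} → sign a ≈ sign b → a ≡.≡ b
    sign-injective {false} {false} _ = ≡.refl
    sign-injective {true} {true} _ = ≡.refl
    sign-injective {false} {true} e = ⊥-elim (1≉-1 e)
    sign-injective {true} {false} e = ⊥-elim (1≉-1 (sym e))

    ω^-multiple : ∀ k → ω^ (k ℕ.* q) ≈ 1#
    ω^-multiple zero = refl
    ω^-multiple (suc k) = trans (pow-+ ω q (k ℕ.* q)) (trans (*-cong ω^q≈1 (ω^-multiple k)) (*-identityˡ _))

    ω^-mod : ∀ a → ω^ (toℕ (a mod q)) ≈ ω^ a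
    ω^-mod a = begin
      ω^ (toℕ (a mod q))              ≈⟨ reflexive (≡.cong ω^_ (toℕ-fromℕ< (m%n<n a q))) ⟩
      ω^ (a % q)                      ≈⟨ *-identityʳ _ ⟨
      ω^ (a % q) * 1#                 ≈⟨ *-congˡ (ω^-multiple (a / q)) ⟨
      ω^ (a % q) * ω^ (a / q ℕ.* q)   ≈⟨ pow-+ ω (a % q) _ ⟨
      ω^ (a % q ℕ.+ a / q ℕ.* q)      ≈⟨ reflexive (≡.cong ω^_ (m≡m%n+[m/n]*n a q)) ⟨
      ω^ a                            ∎

    ω^≉0 : ∀ a → a ≤ q → ¬ (ω^ a ≈ 0#)
    ω^≉0 a a≤q e = nontrivial (begin
      1#                        ≈⟨ ω^q≈1 ⟨
      ω^ q                      ≈⟨ reflexive (≡.cong ω^_ (ℕ.m+[n∸m]≡n a≤q)) ⟨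
      ω^ (a ℕ.+ (q ∸ a))        ≈⟨ pow-+ ω a _ ⟩
      ω^ a * ω^ (q ∸ a)         ≈⟨ *-congʳ e ⟩
      0# * ω^ (q ∸ a)           ≈⟨ zeroˡ _ ⟩
      0#                        ∎)

    ω^-Fin≉0 : ∀ (i : Fin q) → ¬ (ω^ toℕ i ≈ 0#)
    ω^-Fin≉0 i = ω^≉0 (toℕ i) (ℕ.<⇒≤ (toℕ<n i))

    ω^-injective-≤ : ∀ {a b} → a ≤ b → b < q → ω^ a ≈ ω^ b → a ≡.≡ b
    ω^-injective-≤ {a} {b} a≤b b<q e with b ∸ a in b-a
    ... | zero = ≡.trans (≡.sym (ℕ.+-identityʳ a)) (≡.trans (≡.cong (a ℕ.+_) (≡.sym b-a)) (ℕ.m+[n∸m]≡n a≤b))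
    ... | suc d = ⊥-elim (exactOrder (suc d) (s≤s z≤n) (≡.subst (_< q) b-a (ℕ.≤-<-trans (ℕ.m∸n≤m b a) b<q)) ω^[b-a]≈1)
      where
      ω^[b-a]≈1 : ω^ suc d ≈ 1#
      ω^[b-a]≈1 = *-cancelˡ (ω^≉0 a (ℕ.≤-trans a≤b (ℕ.<⇒≤ b<q))) (begin
        ω^ a * ω^ suc d         ≈⟨ pow-+ ω a (suc d) ⟨
        ω^ (a ℕ.+ suc d)        ≈⟨ reflexive (≡.cong (λ n → ω^ (a ℕ.+ n)) b-a) ⟨
        ω^ (a ℕ.+ (b ∸ a))      ≈⟨ reflexive (≡.cong ω^_ (ℕ.m+[n∸m]≡n a≤b)) ⟩
        ω^ b                    ≈⟨ e ⟨
        ω^ a                    ≈⟨ *-identityʳ _ ⟨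
        ω^ a * 1#               ∎)

    ω^-Fin-injective : ∀ (i j : Fin q) → ω^ toℕ i ≈ ω^ toℕ j → i ≡.≡ j
    ω^-Fin-injective i j e with ℕ.≤-total (toℕ i) (toℕ j)
    ... | inj₁ i≤j = toℕ-injective (ω^-injective-≤ i≤j (toℕ<n j) e)
    ... | inj₂ j≤i = toℕ-injective (≡.sym (ω^-injective-≤ j≤i (toℕ<n i) (sym e)))

    x²≈1⇒x≈±1 : ∀ {x} → x * x ≈ 1# → x ≈ 1# ⊎ x ≈ - 1#
    x²≈1⇒x≈±1 {x} x²≈1 with noZeroDivisor (x + - 1#) (x + 1#) product≈0
      where
      product≈0 : (x + - 1#) * (x + 1#) ≈ 0#
      product≈0 = begin
        (x + - 1#) * (x + 1#)                       ≈⟨ foil x (- 1#) 1# ⟩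
        x * x + - 1# * 1# + (x * 1# + - 1# * x)     ≈⟨ +-cong (+-cong x²≈1 (*-identityʳ _)) (+-cong (*-identityʳ x) (-1*x≈-x x)) ⟩
        1# + - 1# + (x + - x)                       ≈⟨ +-cong (-‿inverseʳ 1#) (-‿inverseʳ x) ⟩
        0# + 0#                                     ≈⟨ +-identityˡ 0# ⟩
        0#                                          ∎
    ... | inj₁ x-1≈0 = inj₁ (x-y≈0⇒x≈y x-1≈0)
    ... | inj₂ x+1≈0 = inj₂ (x-y≈0⇒x≈y (trans (+-congˡ (-‿involutive 1#)) x+1≈0))

    ω^half≈-1 : ω^ half ≈ - 1#
    ω^half≈-1 with x²≈1⇒x≈±1 (trans (sym (pow-+ ω half half)) (trans (reflexive (≡.cong ω^_ half+half≡q)) ω^q≈1))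
    ... | inj₂ ω^half≈-1 = ω^half≈-1
    ... | inj₁ ω^half≈1 = ⊥-elim (exactOrder half 0<half half<q ω^half≈1)
      where
      0<half : 0 < half
      0<half with half in h
      ... | zero = ⊥-elim (ℕ.≢-nonZero⁻¹ q (≡.trans (≡.sym half+half≡q) (≡.cong (λ n → n ℕ.+ n) h)))
      ... | suc _ = s≤s z≤n
      half<q : half < q
      half<q = ≡.subst (half <_) half+half≡q (ℕ.m<m+n half 0<half)

    ω^-sign : ∀ b → ω^ (if b then half else 0) ≈ sign b
    ω^-sign false = refl
    ω^-sign true = ω^half≈-1

    ω^-+half : ∀ a → ω^ (a ℕ.+ half) ≈ - ω^ a
    ω^-+half a = trans (pow-+ ω a half) (trans (*-congˡ ω^half≈-1) (trans (*-comm _ _) (-1*x≈-x _)))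

module Spectrum {c ℓ} (R : CommutativeRing c ℓ) (q : ℕ) {{_ : NonZero q}} (2∣q : 2 ∣ q)
                (ω : CommutativeRing.Carrier R) (CS : Walsh.CyclotomicSetting R q ω) where

  open CommutativeRing R
  open Characters R
  open Cyclotomic q 2∣q ω CS
  open import Algebra.Properties.Ring ring using (-1*x≈-x)
  open import Algebra.Properties.CommutativeSemigroup *-commutativeSemigroup using (interchange; xy∙z≈xz∙y)
  open import Data.Bool using (Bool; true; false; not; _xor_; _∧_; if_then_else_)
  open import Data.Bool.Properties using (xor-assoc; xor-comm; xor-same; xor-identityʳ; true-xor; ∧-identityʳ; ∧-zeroʳ)
  open import Data.Bool.Solver using (module xor-∧-Solver)
  open xor-∧-Solver using (solve; _:+_; _:=_)
  import Data.Bool as Bool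
  open import Data.Nat as ℕ using (ℕ; suc; _^_; _/_; _∸_)
  import Data.Nat.Properties as ℕ
  open import Data.Nat.DivMod using (_mod_)
  open import Data.Fin using (Fin; toℕ)
  import Data.Fin as Fin
  open import Data.Vec using (_∷_)
  open import Data.Product using (_×_; _,_)
  open import Data.Sum using (_⊎_; inj₁; inj₂)
  open import Function using (_∘_)
  open import Function.Bundles using (_↔_; _⇔_; Inverse; mk↔ₛ′; mk⇔)
  open import Relation.Nullary using (does; yes; no)
  open import Relation.Nullary.Decidable using (does-⇔; dec-false)
  import Relation.Binary.PropositionalEquality as ≡
  open ≡ using (_≢_)
  import Relation.Binary.Reasoning.Setoid as SetoidReasoning
  module ≈-Reasoning = SetoidReasoning setoid
  open BitVector
  open Counting using (count; count-cong; count-false)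
  open AffineCounting using (Affine; module LevelSets)
  open LinearCounting
    using (isZero; isZero-true; isZero-𝟘; isZero-⊕; countPairs; countPairs-cong; countPairs-true; countPairs-complement;
           distH≡countPairs; not-does≡xor; 2*countPairs-formula)
  open TargetArithmetic

  module GM {m} (π : Bits m ↔ Bits m) (g : Bits m → Fin q) (f : Fn m q)
            (f-def : ∀ x y → f x y ≡.≡ ((if dot x (Inverse.to π y) then q / 2 else 0) ℕ.+ toℕ (g y)) mod q) where

    open Inverse π using () renaming (to to π→; from to π←; strictlyInverseˡ to π→∘π←; strictlyInverseʳ to π←∘π→)

    ω^g : Bits m → Carrier
    ω^g y = ω^ toℕ (g y)

    ω^f : ∀ x y → ω^ toℕ (f x y) ≈ sign (dot x (π→ y)) * ω^g y
    ω^f x y = begin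
      ω^ toℕ (f x y)                                                  ≈⟨ reflexive (≡.cong (ω^_ ∘ toℕ) (f-def x y)) ⟩
      ω^ toℕ (((if dot x (π→ y) then half else 0) ℕ.+ toℕ (g y)) mod q) ≈⟨ ω^-mod _ ⟩
      ω^ ((if dot x (π→ y) then half else 0) ℕ.+ toℕ (g y))            ≈⟨ pow-+ ω (if dot x (π→ y) then half else 0) (toℕ (g y)) ⟩
      ω^ (if dot x (π→ y) then half else 0) * ω^g y                    ≈⟨ *-congʳ (ω^-sign (dot x (π→ y))) ⟩
      sign (dot x (π→ y)) * ω^g y                                      ∎
      where open ≈-Reasoning

    isZero-π→⊕ : ∀ y u → isZero (π→ y ⊕ u) ≡.≡ does (y ≟ π← u)
    isZero-π→⊕ y u = does-⇔ (mk⇔ to from) (π→ y ⊕ u ≟ 𝟘 m) (y ≟ π← u)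
      where
      to : π→ y ⊕ u ≡.≡ 𝟘 m → y ≡.≡ π← u
      to e = ≡.trans (≡.sym (π←∘π→ y)) (≡.cong π← (x⊕y≡𝟘⇒x≡y _ _ e))
      from : y ≡.≡ π← u → π→ y ⊕ u ≡.≡ 𝟘 m
      from e = ≡.trans (≡.cong (λ w → π→ w ⊕ u) e) (≡.trans (≡.cong (_⊕ u) (π→∘π← u)) (⊕-self u))

    walsh : ∀ u v → H ω f u v ≈ fromℕ (2 ^ m) * (ω^g (π← u) * sign (dot (π← u) v))
    walsh u v = begin
      H ω f u v
        ≈⟨ sumPairs m T ⟩
      sumBits m (λ x → sumBits m (λ y → T (x , y)))
        ≈⟨ sumBits-cong m (λ x → sumBits-cong m (λ y → term x y)) ⟩
      sumBits m (λ x → sumBits m (λ y → A y * sign (dot x (π→ y ⊕ u))))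
        ≈⟨ sumBits-swap m m _ ⟩
      sumBits m (λ y → sumBits m (λ x → A y * sign (dot x (π→ y ⊕ u))))
        ≈⟨ sumBits-cong m (λ y → sym (sumBits-scale m (A y) _)) ⟩
      sumBits m (λ y → A y * sumBits m (λ x → sign (dot x (π→ y ⊕ u))))
        ≈⟨ sumBits-cong m (λ y → *-congˡ (character-sum m (π→ y ⊕ u))) ⟩
      sumBits m (λ y → A y * (if isZero (π→ y ⊕ u) then N else 0#))
        ≈⟨ sumBits-cong m (λ y → select (isZero-π→⊕ y u)) ⟩
      sumBits m (λ y → if does (y ≟ π← u) then N * A y else 0#)
        ≈⟨ sumBits-delta m (λ y → N * A y) (π← u) ⟩
      N * A (π← u) ∎
      where
      open ≈-Reasoning
      N = fromℕ (2 ^ m)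
      T : Bits m × Bits m → Carrier
      T (x , y) = ω^ toℕ (f x y) * sign (dot x u xor dot y v)
      A : Bits m → Carrier
      A y = ω^g y * sign (dot y v)
      term : ∀ x y → T (x , y) ≈ A y * sign (dot x (π→ y ⊕ u))
      term x y = begin
        T (x , y)                                                     ≈⟨ *-cong (ω^f x y) (sign-xor (dot x u) (dot y v)) ⟩
        (sign (dot x (π→ y)) * ω^g y) * (sign (dot x u) * sign (dot y v)) ≈⟨ trans (interchange _ _ _ _) (*-comm _ _) ⟩
        A y * (sign (dot x (π→ y)) * sign (dot x u))                   ≈⟨ *-congˡ (sign-xor (dot x (π→ y)) (dot x u)) ⟨
        A y * sign (dot x (π→ y) xor dot x u)                          ≈⟨ *-congˡ (reflexive (≡.cong sign (dot-distribˡ-⊕ x (π→ y) u))) ⟨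
        A y * sign (dot x (π→ y ⊕ u))                                  ∎
      select : ∀ {y b b′} → b ≡.≡ b′ → A y * (if b then N else 0#) ≈ (if b′ then N * A y else 0#)
      select {b = true} ≡.refl = *-comm _ _
      select {b = false} ≡.refl = zeroʳ _

    in-S : ∀ (χ : Bits m → Bool) ζ → (∀ y → ω^g y ≈ sign (χ y) * ζ) →
           ∀ ε → (∀ u v → χ (π← u) xor dot (π← u) v ≡.≡ ε xor (dot u (π→ v) xor χ v)) → InS q ω f
    in-S χ ζ ω^g≈ ε signs = (π , g , f-def) , duality ε ω^g-duality
      where
      open ≈-Reasoning
      ω^g-duality : ∀ u v → ω^g (π← u) * sign (dot (π← u) v) ≈ sign ε * (sign (dot u (π→ v)) * ω^g v)
      ω^g-duality u v = begin
        ω^g (π← u) * sign (dot (π← u) v)                  ≈⟨ *-congʳ (ω^g≈ (π← u)) ⟩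
        (sign (χ (π← u)) * ζ) * sign (dot (π← u) v)       ≈⟨ xy∙z≈xz∙y _ _ _ ⟩
        (sign (χ (π← u)) * sign (dot (π← u) v)) * ζ       ≈⟨ *-congʳ (sign-xor (χ (π← u)) (dot (π← u) v)) ⟨
        sign (χ (π← u) xor dot (π← u) v) * ζ              ≈⟨ *-congʳ (reflexive (≡.cong sign (signs u v))) ⟩
        sign (ε xor (dot u (π→ v) xor χ v)) * ζ           ≈⟨ *-congʳ (trans (sign-xor ε _) (*-congˡ (sign-xor (dot u (π→ v)) (χ v)))) ⟩
        (sign ε * (sign (dot u (π→ v)) * sign (χ v))) * ζ ≈⟨ *-assoc _ _ _ ⟩
        sign ε * ((sign (dot u (π→ v)) * sign (χ v)) * ζ) ≈⟨ *-congˡ (*-assoc _ _ _) ⟩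
        sign ε * (sign (dot u (π→ v)) * (sign (χ v) * ζ)) ≈⟨ *-congˡ (*-congˡ (ω^g≈ v)) ⟨
        sign ε * (sign (dot u (π→ v)) * ω^g v)            ∎
      H≈ : ∀ ε′ → (∀ u v → ω^g (π← u) * sign (dot (π← u) v) ≈ sign ε′ * (sign (dot u (π→ v)) * ω^g v)) →
           ∀ u v → H ω f u v ≈ fromℕ (2 ^ m) * (sign ε′ * ω^ toℕ (f u v))
      H≈ ε′ d u v = trans (walsh u v) (*-congˡ (trans (d u v) (*-congˡ (sym (ω^f u v)))))
      duality : ∀ ε′ → (∀ u v → ω^g (π← u) * sign (dot (π← u) v) ≈ sign ε′ * (sign (dot u (π→ v)) * ω^g v)) →
                SelfDual q ω f ⊎ AntiSelfDual q ω f
      duality false d = inj₁ (λ u v → trans (H≈ false d u v) (*-congˡ (*-identityˡ _)))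
      duality true d = inj₂ (λ u v → trans (H≈ true d u v)
                                     (*-congˡ (trans (-1*x≈-x _) (sym (ω^-+half (toℕ (f u v)))))))

  record NormalForm {m} (f : Fn m q) : Set (c Level.⊔ ℓ) where
    field
      L : Bits m → Bits m
      L-⊕ : ∀ x y → L (x ⊕ y) ≡.≡ L x ⊕ L y
      L-𝟙 : L (𝟙 m) ≡.≡ 𝟙 m
      L-isometry : ∀ x y → dot (L x) (L y) ≡.≡ dot x y
      p : Bits m
      base : Fin q
      ω^f : ∀ x y → ω^ toℕ (f x y) ≈ sign (dot x (L y ⊕ p) xor dot (L y) p) * ω^ toℕ base

  module SelfDualGM {m} (π : Bits m ↔ Bits m) (g : Bits m → Fin q) (f : Fn m q)
    (f-def : ∀ x y → f x y ≡.≡ ((if dot x (Inverse.to π y) then q / 2 else 0) ℕ.+ toℕ (g y)) mod q)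
    (ε : Bool) (duality : ∀ u v → H ω f u v ≈ fromℕ (2 ^ m) * (sign ε * ω^ toℕ (f u v))) where

    open GM π g f f-def
    open Inverse π using () renaming (to to π→; from to π←; strictlyInverseˡ to π→∘π←; strictlyInverseʳ to π←∘π→)

    open IsometryFromDuality π→ ε

    ω^g-duality : ∀ w v → ω^g w * sign (dot w v) ≈ sign ε * (sign (dot (π→ w) (π→ v)) * ω^g v)
    ω^g-duality w v = *-cancelˡ (2^m≉0 m) (begin
      N * (ω^g w * sign (dot w v))                           ≈⟨ reflexive (≡.cong (λ t → N * (ω^g t * sign (dot t v))) (π←∘π→ w)) ⟨
      N * (ω^g (π← (π→ w)) * sign (dot (π← (π→ w)) v))      ≈⟨ walsh (π→ w) v ⟨
      H ω f (π→ w) v                                         ≈⟨ duality (π→ w) v ⟩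
      N * (sign ε * ω^ toℕ (f (π→ w) v))                     ≈⟨ *-congˡ (*-congˡ (ω^f (π→ w) v)) ⟩
      N * (sign ε * (sign (dot (π→ w) (π→ v)) * ω^g v))      ∎)
      where
      open ≈-Reasoning
      N = fromℕ (2 ^ m)

    ω^g≈ : ∀ w → ω^g w ≈ sign (h w) * ω^g (𝟘 m)
    ω^g≈ w = begin
      ω^g w                                          ≈⟨ *-identityʳ _ ⟨
      ω^g w * sign false                             ≈⟨ *-congˡ (reflexive (≡.cong sign (dot-zeroʳ w))) ⟨
      ω^g w * sign (dot w (𝟘 m))                     ≈⟨ ω^g-duality w (𝟘 m) ⟩
      sign ε * (sign (dot (π→ w) p) * ω^g (𝟘 m))     ≈⟨ *-assoc _ _ _ ⟨
      (sign ε * sign (dot (π→ w) p)) * ω^g (𝟘 m)     ≈⟨ *-congʳ (sign-xor ε _) ⟨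
      sign (h w) * ω^g (𝟘 m)                         ∎
      where open ≈-Reasoning

    h-duality : ∀ w v → h w xor dot w v ≡.≡ (ε xor dot (π→ w) (π→ v)) xor h v
    h-duality w v = sign-injective (*-cancelʳ (ω^-Fin≉0 (g (𝟘 m))) (begin
      sign (h w xor dot w v) * G₀                                 ≈⟨ *-congʳ (sign-xor (h w) (dot w v)) ⟩
      (sign (h w) * sign (dot w v)) * G₀                          ≈⟨ xy∙z≈xz∙y _ _ _ ⟩
      (sign (h w) * G₀) * sign (dot w v)                          ≈⟨ *-congʳ (ω^g≈ w) ⟨
      ω^g w * sign (dot w v)                                      ≈⟨ ω^g-duality w v ⟩
      sign ε * (sign (dot (π→ w) (π→ v)) * ω^g v)                 ≈⟨ *-congˡ (*-congˡ (ω^g≈ v)) ⟩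
      sign ε * (sign (dot (π→ w) (π→ v)) * (sign (h v) * G₀))     ≈⟨ *-congˡ (*-assoc _ _ _) ⟨
      sign ε * ((sign (dot (π→ w) (π→ v)) * sign (h v)) * G₀)     ≈⟨ *-assoc _ _ _ ⟨
      (sign ε * (sign (dot (π→ w) (π→ v)) * sign (h v))) * G₀     ≈⟨ *-congʳ (*-assoc _ _ _) ⟨
      ((sign ε * sign (dot (π→ w) (π→ v))) * sign (h v)) * G₀     ≈⟨ *-congʳ (*-congʳ (sign-xor ε _)) ⟨
      (sign (ε xor dot (π→ w) (π→ v)) * sign (h v)) * G₀          ≈⟨ *-congʳ (sign-xor (ε xor dot (π→ w) (π→ v)) (h v)) ⟨
      sign ((ε xor dot (π→ w) (π→ v)) xor h v) * G₀               ∎))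
      where
      open ≈-Reasoning
      G₀ = ω^g (𝟘 m)


    normalForm : NormalForm f
    normalForm = record
      { L = L
      ; L-⊕ = Isometry.L-⊕ L L⁻¹ L∘L⁻¹ (L-isometry h-duality)
      ; L-𝟙 = Isometry.L-𝟙 L L⁻¹ L∘L⁻¹ (L-isometry h-duality)
      ; L-isometry = L-isometry h-duality
      ; p = p
      ; base = g (𝟘 m)
      ; ω^f = ω^f′
      }
      where
      open ≈-Reasoning
      L⁻¹ : Bits m → Bits m
      L⁻¹ z = π← (z ⊕ p)
      L∘L⁻¹ : ∀ z → L (L⁻¹ z) ≡.≡ z
      L∘L⁻¹ z = ≡.trans (≡.cong (_⊕ p) (π→∘π← (z ⊕ p))) (⊕-cancelʳ z p)
      ω^f′ : ∀ x y → ω^ toℕ (f x y) ≈ sign (dot x (L y ⊕ p) xor dot (L y) p) * ω^g (𝟘 m)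
      ω^f′ x y = begin
        ω^ toℕ (f x y)                                       ≈⟨ ω^f x y ⟩
        sign (dot x (π→ y)) * ω^g y                          ≈⟨ *-congˡ (ω^g≈ y) ⟩
        sign (dot x (π→ y)) * (sign (h y) * ω^g (𝟘 m))       ≈⟨ *-assoc _ _ _ ⟨
        (sign (dot x (π→ y)) * sign (h y)) * ω^g (𝟘 m)       ≈⟨ *-congʳ (sign-xor (dot x (π→ y)) (h y)) ⟨
        sign (dot x (π→ y) xor h y) * ω^g (𝟘 m)              ≈⟨ *-congʳ (reflexive (≡.cong sign (≡.cong₂ _xor_ (≡.cong (dot x) (≡.sym (⊕-cancelʳ (π→ y) p))) (h≡dot-L-p h-duality y)))) ⟩
        sign (dot x (L y ⊕ p) xor dot (L y) p) * ω^g (𝟘 m)   ∎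

  normal-form : ∀ {m} (f : Fn m q) → InS q ω f → NormalForm f
  normal-form f ((π , g , f-def) , inj₁ self-dual) = SelfDualGM.normalForm π g f f-def false
    (λ u v → trans (self-dual u v) (*-congˡ (sym (*-identityˡ _))))
  normal-form f ((π , g , f-def) , inj₂ anti-self-dual) = SelfDualGM.normalForm π g f f-def true
    (λ u v → trans (anti-self-dual u v) (*-congˡ (trans (ω^-+half (toℕ (f u v))) (sym (-1*x≈-x _)))))

  shift : Bool → Fin q → Fin q
  shift s j = ((if s then half else 0) ℕ.+ toℕ j) mod q

  ω^-shift : ∀ s j → ω^ toℕ (shift s j) ≈ sign s * ω^ toℕ j
  ω^-shift s j = trans (ω^-mod _) (trans (pow-+ ω (if s then half else 0) (toℕ j)) (*-congʳ (ω^-sign s)))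

  module Pair {m} {f₁ f₂ : Fn m q} (N₁ : NormalForm f₁) (N₂ : NormalForm f₂) where

    open NormalForm N₁ using () renaming (L to L₁; p to p₁; base to base₁; ω^f to ω^f₁)
    open NormalForm N₂ using () renaming (L to L₂; p to p₂; base to base₂; ω^f to ω^f₂)

    B₁ B₂ : Bits m → Bits m → Bool
    B₁ x y = dot x (L₁ y ⊕ p₁) xor dot (L₁ y) p₁
    B₂ x y = dot x (L₂ y ⊕ p₂) xor dot (L₂ y) p₂

    a : Bits m → Bits m
    a y = (L₁ y ⊕ p₁) ⊕ (L₂ y ⊕ p₂)

    k : Bits m → Bool
    k y = dot (L₁ y) p₁ xor dot (L₂ y) p₂

    D : Bits m × Bits m → Bool
    D (x , y) = dot x (a y) xor k y

    B₁-xor-B₂ : ∀ x y → B₁ x y xor B₂ x y ≡.≡ D (x , y)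
    B₁-xor-B₂ x y = ≡.trans (xor-interchange (dot x (L₁ y ⊕ p₁)) (dot (L₁ y) p₁) (dot x (L₂ y ⊕ p₂)) (dot (L₂ y) p₂))
      (≡.cong (_xor k y) (≡.sym (dot-distribˡ-⊕ x _ _)))

    module _ (s : Bool) (base₁≡ : base₁ ≡.≡ shift s base₂) where

      ω^f₁-shifted : ∀ x y → ω^ toℕ (f₁ x y) ≈ sign (B₁ x y xor s) * ω^ toℕ base₂
      ω^f₁-shifted x y = begin
        ω^ toℕ (f₁ x y)                          ≈⟨ ω^f₁ x y ⟩
        sign (B₁ x y) * ω^ toℕ base₁             ≈⟨ *-congˡ (trans (reflexive (≡.cong (ω^_ ∘ toℕ) base₁≡)) (ω^-shift s base₂)) ⟩
        sign (B₁ x y) * (sign s * ω^ toℕ base₂)  ≈⟨ *-assoc _ _ _ ⟨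
        (sign (B₁ x y) * sign s) * ω^ toℕ base₂  ≈⟨ *-congʳ (sign-xor (B₁ x y) s) ⟨
        sign (B₁ x y xor s) * ω^ toℕ base₂       ∎
        where open ≈-Reasoning

      f₁≡f₂⇔ : ∀ x y → (f₁ x y ≡.≡ f₂ x y) ⇔ (B₁ x y xor s ≡.≡ B₂ x y)
      f₁≡f₂⇔ x y = mk⇔
        (λ e → sign-injective (*-cancelʳ (ω^-Fin≉0 base₂)
          (trans (sym (ω^f₁-shifted x y)) (trans (reflexive (≡.cong (ω^_ ∘ toℕ) e)) (ω^f₂ x y)))))
        (λ e → ω^-Fin-injective _ _
          (trans (ω^f₁-shifted x y) (trans (*-congʳ (reflexive (≡.cong sign e))) (sym (ω^f₂ x y)))))

      distance-shifted : distH f₁ f₂ ≡.≡ countPairs m (λ xy → D xy xor s)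
      distance-shifted = distH≡countPairs f₁ f₂ _ λ x y →
        ≡.trans (not-does≡xor (f₁ x y Fin.≟ f₂ x y) (f₁≡f₂⇔ x y))
          (≡.trans (swap (B₁ x y) s (B₂ x y)) (≡.cong (_xor s) (B₁-xor-B₂ x y)))
        where
        swap : ∀ b s c → (b xor s) xor c ≡.≡ (b xor c) xor s
        swap = solve 3 (λ b s c → (b :+ s) :+ c := (b :+ c) :+ s) ≡.refl

    distance-equal : base₁ ≡.≡ shift false base₂ → distH f₁ f₂ ≡.≡ countPairs m D
    distance-equal e = ≡.trans (distance-shifted false e) (countPairs-cong m (λ xy → xor-identityʳ (D xy)))

    distance-opposite : base₁ ≡.≡ shift true base₂ → distH f₁ f₂ ℕ.+ countPairs m D ≡.≡ 2 ^ m ℕ.* 2 ^ m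
    distance-opposite e = ≡.trans (≡.cong (ℕ._+ countPairs m D) (≡.trans (distance-shifted true e)
      (countPairs-cong m (λ xy → ≡.trans (xor-comm (D xy) true) (true-xor (D xy)))))) (countPairs-complement m D)

    distance-unrelated : (∀ s → base₁ ≢ shift s base₂) → distH f₁ f₂ ≡.≡ countPairs m (λ _ → true)
    distance-unrelated unrelated = distH≡countPairs f₁ f₂ _ λ x y →
      ≡.cong not (dec-false (f₁ x y Fin.≟ f₂ x y) (λ e → unrelated (B₁ x y xor B₂ x y) (base₁≡ x y e)))
      where
      open ≈-Reasoning
      base₁≡ : ∀ x y → f₁ x y ≡.≡ f₂ x y → base₁ ≡.≡ shift (B₁ x y xor B₂ x y) base₂
      base₁≡ x y e = ω^-Fin-injective _ _ (begin
        ω^ toℕ base₁                                ≈⟨ sign-transfer (B₁ x y) (B₂ x y) ω^f₁≈ω^f₂ ⟩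
        sign (B₁ x y xor B₂ x y) * ω^ toℕ base₂     ≈⟨ ω^-shift _ base₂ ⟨
        ω^ toℕ (shift (B₁ x y xor B₂ x y) base₂)    ∎)
        where
        ω^f₁≈ω^f₂ : sign (B₁ x y) * ω^ toℕ base₁ ≈ sign (B₂ x y) * ω^ toℕ base₂
        ω^f₁≈ω^f₂ = trans (sym (ω^f₁ x y)) (trans (reflexive (≡.cong (ω^_ ∘ toℕ) e)) (ω^f₂ x y))

  module Forward {m′} {f₁ f₂ : Fn (suc m′) q} (N₁ : NormalForm f₁) (N₂ : NormalForm f₂) where

    private m = suc m′
    open Pair N₁ N₂
    open NormalForm N₁ using () renaming (L to L₁; p to p₁; base to base₁; L-⊕ to L₁-⊕; L-𝟙 to L₁-𝟙; L-isometry to L₁-isometry)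
    open NormalForm N₂ using () renaming (L to L₂; p to p₂; base to base₂; L-⊕ to L₂-⊕; L-𝟙 to L₂-𝟙; L-isometry to L₂-isometry)

    M : Bits m → Bits m
    M y = L₁ y ⊕ L₂ y

    Q : Bits m → Bool
    Q y = isZero (a y)

    M-⊕ : ∀ x y → M (x ⊕ y) ≡.≡ M x ⊕ M y
    M-⊕ x y = ≡.trans (≡.cong₂ _⊕_ (L₁-⊕ x y) (L₂-⊕ x y)) (⊕-interchange _ _ _ _)

    k-⊕ : ∀ x y → k (x ⊕ y) ≡.≡ k x xor k y
    k-⊕ x y = begin
      dot (L₁ (x ⊕ y)) p₁ xor dot (L₂ (x ⊕ y)) p₂
        ≡⟨ ≡.cong₂ _xor_ (≡.cong (λ t → dot t p₁) (L₁-⊕ x y)) (≡.cong (λ t → dot t p₂) (L₂-⊕ x y)) ⟩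
      dot (L₁ x ⊕ L₁ y) p₁ xor dot (L₂ x ⊕ L₂ y) p₂
        ≡⟨ ≡.cong₂ _xor_ (dot-distribʳ-⊕ (L₁ x) _ p₁) (dot-distribʳ-⊕ (L₂ x) _ p₂) ⟩
      (dot (L₁ x) p₁ xor dot (L₁ y) p₁) xor (dot (L₂ x) p₂ xor dot (L₂ y) p₂)
        ≡⟨ xor-interchange (dot (L₁ x) p₁) (dot (L₁ y) p₁) (dot (L₂ x) p₂) (dot (L₂ y) p₂) ⟩
      k x xor k y ∎
      where open ≡.≡-Reasoning

    a≡M⊕c : ∀ y → a y ≡.≡ M y ⊕ (p₁ ⊕ p₂)
    a≡M⊕c y = ⊕-interchange (L₁ y) p₁ (L₂ y) p₂

    Q⇒M≡c : ∀ {y} → Q y ≡.≡ true → M y ≡.≡ p₁ ⊕ p₂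
    Q⇒M≡c {y} e = x⊕y≡𝟘⇒x≡y _ _ (≡.trans (≡.sym (a≡M⊕c y)) (isZero-true (a y) e))

    M≡c⇒Q : ∀ {y} → M y ≡.≡ p₁ ⊕ p₂ → Q y ≡.≡ true
    M≡c⇒Q {y} e = ≡.trans (≡.cong isZero (≡.trans (a≡M⊕c y) (≡.trans (≡.cong (_⊕ (p₁ ⊕ p₂)) e) (⊕-self _)))) (isZero-𝟘 m)

    Q-affine : Affine m Q
    Q-affine x y z qx qy qz = M≡c⇒Q (begin
      M (x ⊕ y ⊕ z)                       ≡⟨ ≡.trans (M-⊕ (x ⊕ y) z) (≡.cong (_⊕ M z) (M-⊕ x y)) ⟩
      M x ⊕ M y ⊕ M z                     ≡⟨ ≡.cong₂ _⊕_ (≡.cong₂ _⊕_ (Q⇒M≡c qx) (Q⇒M≡c qy)) (Q⇒M≡c qz) ⟩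
      (p₁ ⊕ p₂) ⊕ (p₁ ⊕ p₂) ⊕ (p₁ ⊕ p₂)   ≡⟨ ≡.trans (≡.cong (_⊕ (p₁ ⊕ p₂)) (⊕-self _)) (⊕-identityˡ _) ⟩
      p₁ ⊕ p₂                             ∎)
      where open ≡.≡-Reasoning

    k-affine : ∀ x y z → Q x ≡.≡ true → Q y ≡.≡ true → Q z ≡.≡ true → k (x ⊕ y ⊕ z) ≡.≡ k x xor k y xor k z
    k-affine x y z _ _ _ = ≡.trans (k-⊕ (x ⊕ y) z) (≡.trans (≡.cong (_xor k z) (k-⊕ x y)) (xor-assoc (k x) (k y) (k z)))

    k-𝟙 : ∀ {y} → Q y ≡.≡ true → k (𝟙 m) ≡.≡ false
    k-𝟙 {y} qy = begin
      dot (L₁ (𝟙 m)) p₁ xor dot (L₂ (𝟙 m)) p₂           ≡⟨ ≡.cong₂ _xor_ (≡.cong (λ t → dot t p₁) L₁-𝟙) (≡.cong (λ t → dot t p₂) L₂-𝟙) ⟩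
      dot (𝟙 m) p₁ xor dot (𝟙 m) p₂                     ≡⟨ dot-distribˡ-⊕ (𝟙 m) p₁ p₂ ⟨
      dot (𝟙 m) (p₁ ⊕ p₂)                               ≡⟨ ≡.cong (dot (𝟙 m)) (Q⇒M≡c qy) ⟨
      dot (𝟙 m) (L₁ y ⊕ L₂ y)                           ≡⟨ dot-distribˡ-⊕ (𝟙 m) (L₁ y) (L₂ y) ⟩
      dot (𝟙 m) (L₁ y) xor dot (𝟙 m) (L₂ y)             ≡⟨ ≡.cong₂ _xor_ (≡.cong (λ t → dot t (L₁ y)) L₁-𝟙) (≡.cong (λ t → dot t (L₂ y)) L₂-𝟙) ⟨
      dot (L₁ (𝟙 m)) (L₁ y) xor dot (L₂ (𝟙 m)) (L₂ y)   ≡⟨ ≡.cong₂ _xor_ (L₁-isometry (𝟙 m) y) (L₂-isometry (𝟙 m) y) ⟩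
      dot (𝟙 m) y xor dot (𝟙 m) y                       ≡⟨ xor-same (dot (𝟙 m) y) ⟩
      false                                             ∎
      where open ≡.≡-Reasoning

    𝟙-invariant : ∀ y → Q y ≡.≡ true → Q (y ⊕ 𝟙 m) ≡.≡ true × k (y ⊕ 𝟙 m) ≡.≡ k y
    𝟙-invariant y qy =
      M≡c⇒Q (≡.trans (M-⊕ y (𝟙 m)) (≡.trans (≡.cong (M y ⊕_) M𝟙≡𝟘) (≡.trans (⊕-identityʳ _) (Q⇒M≡c qy)))) ,
      ≡.trans (k-⊕ y (𝟙 m)) (≡.trans (≡.cong (k y xor_) (k-𝟙 qy)) (xor-identityʳ (k y)))
      where
      M𝟙≡𝟘 : M (𝟙 m) ≡.≡ 𝟘 m
      M𝟙≡𝟘 = ≡.trans (≡.cong₂ _⊕_ L₁-𝟙 L₂-𝟙) (⊕-self (𝟙 m))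

    open LevelSets Q k

    shape : Shape m (countPairs m D)
    shape = shape-from-levels m′ (2*countPairs-formula m a k) count-levels
              (level-sizes Q-affine k-affine (𝟙 m) 𝟙-invariant x⊕𝟙≢x)

    distance-in-target : InTarget m (distH f₁ f₂)
    distance-in-target with base₁ Fin.≟ shift false base₂ | base₁ Fin.≟ shift true base₂
    ... | yes e | _ = ≡.subst (InTarget m) (≡.sym (distance-equal e)) (shape⇒target shape)
    ... | no _ | yes e = shape⇒target (shape-complement m′ (distance-opposite e) shape)
    ... | no ≢₀ | no ≢₁ = shape⇒target (shape-full m′ _ (≡.trans (distance-unrelated unrelated) (countPairs-true m)))
      where
      unrelated : ∀ s → base₁ ≢ shift s base₂
      unrelated false = ≢₀
      unrelated true = ≢₁

  gm : ∀ {m} → Bits m ↔ Bits m → (Bits m → Fin q) → Fn m q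
  gm π g x y = ((if dot x (Inverse.to π y) then q / 2 else 0) ℕ.+ toℕ (g y)) mod q

  module Examples (m′ : ℕ) where

    private m = suc m′
    open Rotation

    0F : Fin q
    0F = 0 mod q

    rotation : ℕ → Bits m ↔ Bits m
    rotation t = mk↔ₛ′ (rot t) (unrot t) (rot-unrot t) (unrot-rot t)

    rotated : ℕ → Fin q → Fn m q
    rotated t c = gm (rotation t) (λ _ → c)

    rotated-in-S : ∀ t c → InS q ω (rotated t c)
    rotated-in-S t c = GM.in-S (rotation t) (λ _ → c) (rotated t c) (λ _ _ → ≡.refl)
      (λ _ → false) (ω^ toℕ c) (λ _ → sym (*-identityˡ _)) false
      (λ u v → ≡.trans (≡.sym (dot-rot t u v)) (≡.sym (xor-identityʳ _)))

    rotated-normal : ∀ t c → NormalForm (rotated t c)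
    rotated-normal t c = record
      { L = rot t
      ; L-⊕ = Isometry.L-⊕ (rot t) (unrot t) (rot-unrot t) (rot-isometry t)
      ; L-𝟙 = Isometry.L-𝟙 (rot t) (unrot t) (rot-unrot t) (rot-isometry t)
      ; L-isometry = rot-isometry t
      ; p = 𝟘 m
      ; base = c
      ; ω^f = λ x y → trans (GM.ω^f (rotation t) (λ _ → c) (rotated t c) (λ _ _ → ≡.refl) x y)
                        (*-congʳ (reflexive (≡.cong sign (without-p x (rot t y)))))
      }
      where
      without-p : ∀ x z → dot x z ≡.≡ dot x (z ⊕ 𝟘 m) xor dot z (𝟘 m)
      without-p x z = ≡.sym (≡.trans (≡.cong₂ _xor_ (≡.cong (dot x) (⊕-identityʳ z)) (dot-zeroʳ z)) (xor-identityʳ _))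

    e : Bits m
    e = true ∷ 𝟘 m′

    translation : Bits m ↔ Bits m
    translation = mk↔ₛ′ (_⊕ e) (_⊕ e) (λ y → ⊕-cancelʳ y e) (λ y → ⊕-cancelʳ y e)

    translated : Fn m q
    translated = gm translation (λ y → shift (dot e y) 0F)

    translated-in-S : InS q ω translated
    translated-in-S = GM.in-S translation _ translated (λ _ _ → ≡.refl)
      (dot e) (ω^ toℕ 0F) (λ y → ω^-shift (dot e y) 0F) true signs
      where
      open ≡.≡-Reasoning
      regroup : ∀ t a b c → (a xor t) xor (b xor c) ≡.≡ t xor ((b xor a) xor c)
      regroup = solve 4 (λ t a b c → (a :+ t) :+ (b :+ c) := t :+ ((b :+ a) :+ c)) ≡.refl
      signs : ∀ u v → dot e (u ⊕ e) xor dot (u ⊕ e) v ≡.≡ true xor (dot u (v ⊕ e) xor dot e v)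
      signs u v = begin
        dot e (u ⊕ e) xor dot (u ⊕ e) v                   ≡⟨ ≡.cong₂ _xor_ (dot-distribˡ-⊕ e u e) (dot-distribʳ-⊕ u e v) ⟩
        (dot e u xor dot e e) xor (dot u v xor dot e v)   ≡⟨ ≡.cong (λ t → (dot e u xor t) xor (dot u v xor dot e v)) (≡.cong not (dot-zeroʳ (𝟘 m′))) ⟩
        (dot e u xor true) xor (dot u v xor dot e v)      ≡⟨ regroup true (dot e u) (dot u v) (dot e v) ⟩
        true xor ((dot u v xor dot e u) xor dot e v)      ≡⟨ ≡.cong (λ t → true xor ((dot u v xor t) xor dot e v)) (dot-comm e u) ⟩
        true xor ((dot u v xor dot u e) xor dot e v)      ≡⟨ ≡.cong (λ t → true xor (t xor dot e v)) (dot-distribˡ-⊕ u v e) ⟨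
        true xor (dot u (v ⊕ e) xor dot e v)              ∎

    translated-normal : NormalForm translated
    translated-normal = record
      { L = λ y → y
      ; L-⊕ = λ _ _ → ≡.refl
      ; L-𝟙 = ≡.refl
      ; L-isometry = λ _ _ → ≡.refl
      ; p = e
      ; base = 0F
      ; ω^f = ω^f
      }
      where
      open ≈-Reasoning
      ω^f : ∀ x y → ω^ toℕ (translated x y) ≈ sign (dot x (y ⊕ e) xor dot y e) * ω^ toℕ 0F
      ω^f x y = begin
        ω^ toℕ (translated x y)                             ≈⟨ GM.ω^f translation _ translated (λ _ _ → ≡.refl) x y ⟩
        sign (dot x (y ⊕ e)) * ω^ toℕ (shift (dot e y) 0F)  ≈⟨ *-congˡ (ω^-shift (dot e y) 0F) ⟩
        sign (dot x (y ⊕ e)) * (sign (dot e y) * ω^ toℕ 0F) ≈⟨ *-assoc _ _ _ ⟨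
        (sign (dot x (y ⊕ e)) * sign (dot e y)) * ω^ toℕ 0F ≈⟨ *-congʳ (sign-xor (dot x (y ⊕ e)) (dot e y)) ⟨
        sign (dot x (y ⊕ e) xor dot e y) * ω^ toℕ 0F        ≈⟨ *-congʳ (reflexive (≡.cong (λ t → sign (dot x (y ⊕ e) xor t)) (dot-comm e y))) ⟩
        sign (dot x (y ⊕ e) xor dot y e) * ω^ toℕ 0F        ∎

    module RotatedPair (t : ℕ) (t≤m′ : t ℕ.≤ m′) (s : Bool) where

      open Pair (rotated-normal 0 (shift s 0F)) (rotated-normal t 0F) public
      open LevelSets (isZero ∘ a) k

      k≡false : ∀ y → k y ≡.≡ false
      k≡false y = ≡.cong₂ _xor_ (dot-zeroʳ y) (dot-zeroʳ (rot t y))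

      isZero-a : ∀ y → isZero (a y) ≡.≡ fixed-points t m y
      isZero-a y = ≡.trans (≡.cong isZero (≡.cong₂ _⊕_ (⊕-identityʳ y) (⊕-identityʳ (rot t y)))) (isZero-⊕ y (rot t y))

      count-level-true : count m (level true) ≡.≡ 0
      count-level-true = ≡.trans (count-cong m (λ y → ≡.trans (≡.cong (isZero (a y) ∧_) (k≡false y)) (∧-zeroʳ _))) (count-false m)

      count-level-false : count m (level false) ≡.≡ 2 ^ suc (m′ ∸ t)
      count-level-false = ≡.trans (count-cong m λ y → ≡.trans (≡.cong₂ (λ b c → b ∧ not c) (isZero-a y) (k≡false y)) (∧-identityʳ _))
        (count-fixed-points t m′ t≤m′)

      countPairs+offset : countPairs m D ℕ.+ offset m t ≡.≡ centre m
      countPairs+offset = ≡.subst (λ r → countPairs m D ℕ.+ offset m r ≡.≡ centre m) (ℕ.m∸[m∸n]≡n t≤m′)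
        (below-from-levels m′ (2*countPairs-formula m a k) count-levels (ℕ.m∸n≤m m′ t) count-level-true count-level-false)


    module TranslatedPair where

      open Pair (rotated-normal 0 (shift false 0F)) translated-normal
      open LevelSets (isZero ∘ a) k

      a≡e : ∀ y → a y ≡.≡ e
      a≡e y = ≡.trans (≡.cong (_⊕ (y ⊕ e)) (⊕-identityʳ y)) (≡.trans (≡.sym (⊕-assoc y y e)) (≡.trans (≡.cong (_⊕ e) (⊕-self y)) (⊕-identityˡ e)))

      count-level : ∀ b → count m (level b) ≡.≡ 0
      count-level b = ≡.trans (count-cong m (λ y → ≡.cong (λ z → isZero z ∧ (if b then k y else not (k y))) (a≡e y))) (count-false m)

      distance : distH (rotated 0 (shift false 0F)) translated ≡.≡ centre m
      distance = ≡.trans (distance-equal ≡.refl)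
        (centred-from-levels m′ (2*countPairs-formula m a k) count-levels (≡.trans (count-level false) (≡.sym (count-level true))))

    backward : ∀ d → InTarget m d → InSpectrum m q ω d
    backward d (inj₁ d≡c) = rotated 0 (shift false 0F) , translated , rotated-in-S 0 _ , translated-in-S ,
      ≡.trans TranslatedPair.distance (≡.sym d≡c)
    backward d (inj₂ (t , ℕ.s≤s t≤m′ , inj₂ d≡c∸o)) = rotated 0 (shift false 0F) , rotated t 0F , rotated-in-S 0 _ , rotated-in-S t 0F ,
      ≡.trans (distance-equal ≡.refl)
        (≡.trans (≡.sym (ℕ.m+n∸n≡m _ (offset m t))) (≡.trans (≡.cong (_∸ offset m t) countPairs+offset) (≡.sym d≡c∸o)))
      where open RotatedPair t t≤m′ false
    backward d (inj₂ (t , ℕ.s≤s t≤m′ , inj₁ d≡c+o)) = rotated 0 (shift true 0F) , rotated t 0F , rotated-in-S 0 _ , rotated-in-S t 0F ,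
      ≡.trans (complement-below m′ (distance-opposite ≡.refl) countPairs+offset) (≡.sym d≡c+o)
      where open RotatedPair t t≤m′ true

open import Data.Nat using (zero; suc)
open import Data.Product using (_,_)
open import Function.Bundles using (mk⇔)
open import Relation.Binary.PropositionalEquality using (refl)

proposition4 : ∀ {c ℓ : Level} (R : CommutativeRing c ℓ)
    (q : ℕ) {{_ : NonZero q}} → 2 ∣ q →
    (ω : CommutativeRing.Carrier R) → Walsh.CyclotomicSetting R q ω →
    (m : ℕ) → 1 ≤ m →
    ∀ (d : ℕ) → (Walsh.InSpectrum R m q ω d ⇔ InTarget m d)
proposition4 R q 2∣q ω CS zero () d
proposition4 R q 2∣q ω CS (suc m′) _ d = mk⇔ forward (Examples.backward m′ d)
  where
  open Spectrum R q 2∣q ω CS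
  forward : Walsh.InSpectrum R (suc m′) q ω d → InTarget (suc m′) d
  forward (f₁ , f₂ , f₁∈S , f₂∈S , refl) = Forward.distance-in-target (normal-form f₁ f₁∈S) (normal-form f₂ f₂∈S)
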